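{- Let $p$ be a prime, let $n$ be a positive integer and let $U\subseteq\mathbb F_p^2$ with $(n-1)p<\#U\leq np$. Suppose that $m\in\mathbb F_p$ is not a $U$-special direction. Then for every integer $0\leq\alpha\leq n$, the polynomial $(x^p-x)^{n-\alpha}$ divides $(\partial_y^\alpha H_{U,n})(x,m)$ in $\mathbb F_p[x]$.
   Context: A line of $\mathbb F_p^2$ is either $\{(u,v): v=mu-k\}$ with $m,k\in\mathbb F_p$ (slope $m$) or a vertical set $\{(u,v):u=c\}$ (slope $\infty$). For $U\subseteq\mathbb F_p^2$ put $\theta=\#U/p$; a line $\ell$ is $U$-rich if $\#(\ell\cap U)\geq\theta+1$ and $U$-poor if $\#(\ell\cap U)\leq\theta-1$; a direction is $U$-special if some line with that slope is $U$-rich or $U$-poor. The Rédei polynomial is $R_U(x,y)=\prod_{(a,b)\in U}(x-ay+b)\in\mathbb F_p[x,y]$, monic in $x$ of degree $\#U$. For $np\geq\#U$, $S_{U,n}$ is the quotient of the long division of $(x^p-x)^n$ by $R_U$ in $(\mathbb F_p[y])[x]$ (so $(x^p-x)^n=R_US_{U,n}+T_{U,n}$ with $\deg_xT_{U,n}<\#U$), and $H_{U,n}:=R_US_{U,n}$. $\partial_y^\alpha$ denotes the $\alpha$-th iterated partial derivative with respect to $y$. -}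

module Defs where

open import Data.Nat as ℕ using (ℕ; zero; suc; _%_)
open import Data.Nat.Primality using (Prime)
open import Data.Integer as ℤ using (ℤ; +_; -_)
open import Data.Integer.Divisibility using (_∣_)
open import Data.Fin using (Fin; toℕ)
open import Data.List using (List; []; _∷_; foldr; map; length; filter; replicate; _++_)
open import Data.Product using (_×_; _,_)
open import Relation.Nullary using (¬_)
open import Relation.Binary.PropositionalEquality using (_≡_)
open import Data.Nat.Properties using (_≟_)

-- Arithmetic in 𝔽_p is modelled by integer representatives up to
-- congruence modulo p.

_≡_[mod_] : ℤ → ℤ → ℕ → Set
a ≡ b [mod p ] = (+ p) ∣ (a ℤ.- b)

-- Univariate polynomials as coefficient lists (index i = coefficient
-- of the i-th power), over an arbitrary coefficient type with 0,+,*.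

record Ops (A : Set) : Set where
  field
    zr  : A
    one : A
    add : A → A → A
    mul : A → A → A

module PolyOps {A : Set} (O : Ops A) where
  open Ops O

  addP : List A → List A → List A
  addP [] q = q
  addP (a ∷ p) [] = a ∷ p
  addP (a ∷ p) (b ∷ q) = add a b ∷ addP p q

  mulP : List A → List A → List A
  mulP [] q = []
  mulP (a ∷ p) q = addP (map (mul a) q) (zr ∷ mulP p q)

  polyOps : Ops (List A)
  polyOps = record { zr = [] ; one = one ∷ [] ; add = addP ; mul = mulP }

  powP : List A → ℕ → List A
  powP f zero = one ∷ []
  powP f (suc k) = mulP f (powP f k)

ℤOps : Ops ℤ
ℤOps = record { zr = + 0 ; one = + 1 ; add = ℤ._+_ ; mul = ℤ._*_ }

Poly : Set
Poly = List ℤ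

-- ℤ[y][x] : outer list indexed by the power of x, inner list by the power of y
BiPoly : Set
BiPoly = List Poly

module P1 = PolyOps ℤOps
module P2 = PolyOps P1.polyOps

_*₁_ : Poly → Poly → Poly
_*₁_ = P1.mulP

_*₂_ : BiPoly → BiPoly → BiPoly
_*₂_ = P2.mulP

coeff : Poly → ℕ → ℤ
coeff [] _ = + 0
coeff (c ∷ cs) zero = c
coeff (c ∷ cs) (suc i) = coeff cs i

coeff₂ : BiPoly → ℕ → Poly
coeff₂ [] _ = []
coeff₂ (c ∷ cs) zero = c
coeff₂ (c ∷ cs) (suc i) = coeff₂ cs i

_≈₁_[mod_] : Poly → Poly → ℕ → Set
f ≈₁ g [mod p ] = ∀ i → coeff f i ≡ coeff g i [mod p ]

_≈₂_[mod_] : BiPoly → BiPoly → ℕ → Set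
f ≈₂ g [mod p ] = ∀ i j → coeff (coeff₂ f i) j ≡ coeff (coeff₂ g i) j [mod p ]

DegXBelow : BiPoly → ℕ → ℕ → Set
DegXBelow f d p = ∀ i j → d ℕ.≤ i → coeff (coeff₂ f i) j ≡ + 0 [mod p ]

_∣₁_[mod_] : Poly → Poly → ℕ → Set
g ∣₁ f [mod p ] = Data.Product.Σ Poly (λ h → f ≈₁ (g *₁ h) [mod p ])
  where import Data.Product

monoX₂ : ℕ → Poly → BiPoly
monoX₂ k c = replicate k [] ++ (c ∷ [])

xp-x₂ : ℕ → BiPoly
xp-x₂ p = P2.addP (monoX₂ p (+ 1 ∷ [])) (monoX₂ 1 (- (+ 1) ∷ []))

monoX₁ : ℕ → ℤ → Poly
monoX₁ k c = replicate k (+ 0) ++ (c ∷ [])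

xp-x₁ : ℕ → Poly
xp-x₁ p = P1.addP (monoX₁ p (+ 1)) (monoX₁ 1 (- (+ 1)))

Point : ℕ → Set
Point p = Fin p × Fin p

-- the factor x - a y + b
redeiFactor : ∀ {p} → Point p → BiPoly
redeiFactor (a , b) = ((+ toℕ b) ∷ (- (+ toℕ a)) ∷ []) ∷ (+ 1 ∷ []) ∷ []

Redei : ∀ {p} → List (Point p) → BiPoly
Redei U = foldr (λ pt acc → redeiFactor pt *₂ acc) ((+ 1 ∷ []) ∷ []) U

-- (u,v) lies on {v = m u - k}  ⇔  v + k ≡ m u (mod p)
-- (Fin 0 is empty, so the case p = 0 is vacuous.)
lineCount : ∀ {p} → List (Point p) → Fin p → Fin p → ℕ
lineCount {zero} U m k = 0
lineCount {suc q} U m k =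
  length (filter (λ { (u , v) → (toℕ v ℕ.+ toℕ k) % suc q ≟ (toℕ m ℕ.* toℕ u) % suc q }) U)

-- with θ = #U/p:  count ≥ θ + 1  ⇔  p·count ≥ #U + p
Rich : ∀ {p} → List (Point p) → Fin p → Fin p → Set
Rich {p} U m k = length U ℕ.+ p ℕ.≤ p ℕ.* lineCount U m k

-- count ≤ θ - 1  ⇔  p·count + p ≤ #U
Poor : ∀ {p} → List (Point p) → Fin p → Fin p → Set
Poor {p} U m k = p ℕ.* lineCount U m k ℕ.+ p ℕ.≤ length U

Special : ∀ {p} → List (Point p) → Fin p → Set
Special U m = Data.Product.∃ (λ k → Data.Sum._⊎_ (Rich U m k) (Poor U m k))
  where import Data.Product; import Data.Sum

dAux : ℕ → Poly → Poly
dAux k [] = []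
dAux k (c ∷ cs) = ((+ k) ℤ.* c) ∷ dAux (suc k) cs

dY₁ : Poly → Poly
dY₁ [] = []
dY₁ (_ ∷ cs) = dAux 1 cs

∂y : BiPoly → BiPoly
∂y = map dY₁

∂y^ : ℕ → BiPoly → BiPoly
∂y^ zero f = f
∂y^ (suc α) f = ∂y (∂y^ α f)

evalY : ℤ → Poly → ℤ
evalY m = foldr (λ c acc → c ℤ.+ m ℤ.* acc) (+ 0)

atY : BiPoly → ℤ → Poly
atY f m = map (evalY m) f

module Submission where

-- Evaluate the division (x^p − x)^n = R_U S + T at y = m. As m is not special, every line
-- v = m u − k holds c_k ∈ {n − 1, n} points of U, and R_U(x, m) = ∏_k (x − k)^(c_k).
-- Each (x − k)^(c_k) divides (x^p − x)^n and R_U(x, m), hence T(x, m); since deg T(x, m) < #U ≤ Σ c_k,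
-- T(x, m) = 0. Where c_k = n − 1, comparing multiplicities of x − k in (x^p − x)^n = R_U(x, m) S(x, m)
-- shows x − k ∣ S(x, m). So H = R_U S vanishes at x = k to order n in a way that survives ∂_y: every
-- factor x − a y + b of R_U is linear in y, and by the Leibniz rule ∂_y^α H(x, m) keeps the factor
-- (x − k)^(n − α). Finally x^p − x = ∏_k (x − k) by Fermat's little theorem.

open import Level using (0ℓ)
open import Algebra.Bundles using (CommutativeRing)
open import Data.Nat using (ℕ; suc)
open import Data.Nat.Primality using (Prime)
open import Data.Fin using (Fin)
open import Data.List using (List)
open import Defs using (Point)

module Polynomials where

  open import Algebra.Structures using (IsCommutativeRing)
  open import Data.Nat using (ℕ; zero; suc)
  open import Data.List using ([]; _∷_; map; foldr)
  open import Data.Maybe using (nothing)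
  open import Data.Product using (_,_)
  open import Relation.Binary.Structures using (IsEquivalence)
  open import Relation.Binary.PropositionalEquality as ≡ using (_≡_)
  open import Tactic.RingSolver.Core.AlmostCommutativeRing using (fromCommutativeRing)
  import Tactic.RingSolver.NonReflective as RingSolver
  open import Defs using (Ops; module PolyOps)
  open import Algebra.Morphism.Structures using (IsRingHomomorphism)

  module ListPolynomial (R : CommutativeRing 0ℓ 0ℓ) where

    open CommutativeRing R renaming (Carrier to A) hiding (zero; isCommutativeRing)
    open import Relation.Binary.Reasoning.Setoid setoid
    open import Algebra.Properties.Ring ring using (-0#≈0#; -‿distribʳ-*)
    open import Algebra.Properties.AbelianGroup +-abelianGroup using (⁻¹-∙-comm)
    open import Algebra.Properties.CommutativeSemigroup +-commutativeSemigroup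
      using () renaming (interchange to +-interchange)
    open import Algebra.Properties.CommutativeSemigroup *-commutativeSemigroup using (x∙yz≈y∙xz)

    coefficientOps : Ops A
    coefficientOps = record { zr = 0# ; one = 1# ; add = _+_ ; mul = _*_ }

    open PolyOps coefficientOps public

    Polynomial : Set
    Polynomial = List A

    coeff : Polynomial → ℕ → A
    coeff [] _ = 0#
    coeff (a ∷ _) zero = a
    coeff (_ ∷ f) (suc i) = coeff f i

    infix 4 _≈ₚ_
    record _≈ₚ_ (f g : Polynomial) : Set where
      constructor mk≈ₚ
      field coeff-≈ : ∀ i → coeff f i ≈ coeff g i
    open _≈ₚ_ public

    ≈ₚ-refl : ∀ {f} → f ≈ₚ f
    ≈ₚ-refl = mk≈ₚ λ _ → refl

    ≈ₚ-sym : ∀ {f g} → f ≈ₚ g → g ≈ₚ f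
    ≈ₚ-sym e = mk≈ₚ λ i → sym (coeff-≈ e i)

    ≈ₚ-trans : ∀ {f g h} → f ≈ₚ g → g ≈ₚ h → f ≈ₚ h
    ≈ₚ-trans e e′ = mk≈ₚ λ i → trans (coeff-≈ e i) (coeff-≈ e′ i)

    ≈ₚ-reflexive : ∀ {f g} → f ≡ g → f ≈ₚ g
    ≈ₚ-reflexive ≡.refl = ≈ₚ-refl

    ≈ₚ-isEquivalence : IsEquivalence _≈ₚ_
    ≈ₚ-isEquivalence = record { refl = ≈ₚ-refl ; sym = ≈ₚ-sym ; trans = ≈ₚ-trans }

    ∷-cong : ∀ {a b f g} → a ≈ b → f ≈ₚ g → a ∷ f ≈ₚ b ∷ g
    ∷-cong a≈b f≈g = mk≈ₚ λ { zero → a≈b ; (suc i) → coeff-≈ f≈g i }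

    ∷-injectiveˡ : ∀ {a b f g} → a ∷ f ≈ₚ b ∷ g → a ≈ b
    ∷-injectiveˡ e = coeff-≈ e zero

    ∷-injectiveʳ : ∀ {a b f g} → a ∷ f ≈ₚ b ∷ g → f ≈ₚ g
    ∷-injectiveʳ e = mk≈ₚ λ i → coeff-≈ e (suc i)

    []≈∷ : ∀ {a f} → a ≈ 0# → [] ≈ₚ f → [] ≈ₚ a ∷ f
    []≈∷ a≈0 []≈f = mk≈ₚ λ { zero → sym a≈0 ; (suc i) → coeff-≈ []≈f i }

    []≈∷⇒≈0 : ∀ {a f} → [] ≈ₚ a ∷ f → a ≈ 0#
    []≈∷⇒≈0 e = sym (coeff-≈ e zero)

    []≈∷⇒[]≈ : ∀ {a f} → [] ≈ₚ a ∷ f → [] ≈ₚ f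
    []≈∷⇒[]≈ e = mk≈ₚ λ i → coeff-≈ e (suc i)

    shift : Polynomial → Polynomial
    shift f = 0# ∷ f

    scale : A → Polynomial → Polynomial
    scale a = map (a *_)

    negate : Polynomial → Polynomial
    negate = map (λ a → - a)

    constant : A → Polynomial
    constant a = a ∷ []

    1ₚ : Polynomial
    1ₚ = constant 1#

    coeff-addP : ∀ f g i → coeff (addP f g) i ≈ coeff f i + coeff g i
    coeff-addP [] g i = sym (+-identityˡ _)
    coeff-addP (a ∷ f) [] zero = sym (+-identityʳ _)
    coeff-addP (a ∷ f) [] (suc i) = sym (+-identityʳ _)
    coeff-addP (a ∷ f) (b ∷ g) zero = refl
    coeff-addP (a ∷ f) (b ∷ g) (suc i) = coeff-addP f g i

    coeff-scale : ∀ a f i → coeff (scale a f) i ≈ a * coeff f i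
    coeff-scale a [] i = sym (zeroʳ a)
    coeff-scale a (b ∷ f) zero = refl
    coeff-scale a (b ∷ f) (suc i) = coeff-scale a f i

    coeff-negate : ∀ f i → coeff (negate f) i ≈ - coeff f i
    coeff-negate [] i = sym -0#≈0#
    coeff-negate (b ∷ f) zero = refl
    coeff-negate (b ∷ f) (suc i) = coeff-negate f i

    addP-cong : ∀ {f f′ g g′} → f ≈ₚ f′ → g ≈ₚ g′ → addP f g ≈ₚ addP f′ g′
    addP-cong {f} {f′} {g} {g′} e e′ = mk≈ₚ λ i → begin
      coeff (addP f g) i        ≈⟨ coeff-addP f g i ⟩
      coeff f i + coeff g i     ≈⟨ +-cong (coeff-≈ e i) (coeff-≈ e′ i) ⟩
      coeff f′ i + coeff g′ i   ≈⟨ coeff-addP f′ g′ i ⟨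
      coeff (addP f′ g′) i      ∎

    addP-comm : ∀ f g → addP f g ≈ₚ addP g f
    addP-comm f g = mk≈ₚ λ i → begin
      coeff (addP f g) i      ≈⟨ coeff-addP f g i ⟩
      coeff f i + coeff g i   ≈⟨ +-comm _ _ ⟩
      coeff g i + coeff f i   ≈⟨ coeff-addP g f i ⟨
      coeff (addP g f) i      ∎

    addP-assoc : ∀ f g h → addP (addP f g) h ≈ₚ addP f (addP g h)
    addP-assoc f g h = mk≈ₚ λ i → begin
      coeff (addP (addP f g) h) i                ≈⟨ coeff-addP (addP f g) h i ⟩
      coeff (addP f g) i + coeff h i             ≈⟨ +-congʳ (coeff-addP f g i) ⟩
      (coeff f i + coeff g i) + coeff h i        ≈⟨ +-assoc _ _ _ ⟩
      coeff f i + (coeff g i + coeff h i)        ≈⟨ +-congˡ (coeff-addP g h i) ⟨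
      coeff f i + coeff (addP g h) i             ≈⟨ coeff-addP f (addP g h) i ⟨
      coeff (addP f (addP g h)) i                ∎

    addP-identityʳ : ∀ f → addP f [] ≈ₚ f
    addP-identityʳ [] = ≈ₚ-refl
    addP-identityʳ (a ∷ f) = ≈ₚ-refl

    addP-interchange : ∀ f g h k → addP (addP f g) (addP h k) ≈ₚ addP (addP f h) (addP g k)
    addP-interchange f g h k = mk≈ₚ λ i → begin
      coeff (addP (addP f g) (addP h k)) i                    ≈⟨ coeff-addP (addP f g) (addP h k) i ⟩
      coeff (addP f g) i + coeff (addP h k) i                 ≈⟨ +-cong (coeff-addP f g i) (coeff-addP h k i) ⟩
      (coeff f i + coeff g i) + (coeff h i + coeff k i)       ≈⟨ +-interchange _ _ _ _ ⟩
      (coeff f i + coeff h i) + (coeff g i + coeff k i)       ≈⟨ +-cong (coeff-addP f h i) (coeff-addP g k i) ⟨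
      coeff (addP f h) i + coeff (addP g k) i                 ≈⟨ coeff-addP (addP f h) (addP g k) i ⟨
      coeff (addP (addP f h) (addP g k)) i                    ∎

    addP-swap : ∀ f g h → addP f (addP g h) ≈ₚ addP g (addP f h)
    addP-swap f g h = ≈ₚ-trans (≈ₚ-sym (addP-assoc f g h))
      (≈ₚ-trans (addP-cong (addP-comm f g) ≈ₚ-refl) (addP-assoc g f h))

    negate-cong : ∀ {f g} → f ≈ₚ g → negate f ≈ₚ negate g
    negate-cong {f} {g} e = mk≈ₚ λ i →
      trans (coeff-negate f i) (trans (-‿cong (coeff-≈ e i)) (sym (coeff-negate g i)))

    addP-inverseˡ : ∀ f → addP (negate f) f ≈ₚ []
    addP-inverseˡ f = mk≈ₚ λ i →
      trans (coeff-addP (negate f) f i) (trans (+-congʳ (coeff-negate f i)) (-‿inverseˡ _))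

    addP-inverseʳ : ∀ f → addP f (negate f) ≈ₚ []
    addP-inverseʳ f = mk≈ₚ λ i →
      trans (coeff-addP f (negate f) i) (trans (+-congˡ (coeff-negate f i)) (-‿inverseʳ _))

    scale-cong : ∀ {a b f g} → a ≈ b → f ≈ₚ g → scale a f ≈ₚ scale b g
    scale-cong {a} {b} {f} {g} a≈b f≈g = mk≈ₚ λ i →
      trans (coeff-scale a f i) (trans (*-cong a≈b (coeff-≈ f≈g i)) (sym (coeff-scale b g i)))

    scale-distribˡ : ∀ a f g → scale a (addP f g) ≈ₚ addP (scale a f) (scale a g)
    scale-distribˡ a f g = mk≈ₚ λ i → begin
      coeff (scale a (addP f g)) i                  ≈⟨ coeff-scale a (addP f g) i ⟩
      a * coeff (addP f g) i                        ≈⟨ *-congˡ (coeff-addP f g i) ⟩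
      a * (coeff f i + coeff g i)                   ≈⟨ distribˡ _ _ _ ⟩
      a * coeff f i + a * coeff g i                 ≈⟨ +-cong (coeff-scale a f i) (coeff-scale a g i) ⟨
      coeff (scale a f) i + coeff (scale a g) i     ≈⟨ coeff-addP (scale a f) (scale a g) i ⟨
      coeff (addP (scale a f) (scale a g)) i        ∎

    scale-distribʳ : ∀ a b f → scale (a + b) f ≈ₚ addP (scale a f) (scale b f)
    scale-distribʳ a b f = mk≈ₚ λ i → begin
      coeff (scale (a + b) f) i                     ≈⟨ coeff-scale (a + b) f i ⟩
      (a + b) * coeff f i                           ≈⟨ distribʳ (coeff f i) a b ⟩
      a * coeff f i + b * coeff f i                 ≈⟨ +-cong (coeff-scale a f i) (coeff-scale b f i) ⟨
      coeff (scale a f) i + coeff (scale b f) i     ≈⟨ coeff-addP (scale a f) (scale b f) i ⟨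
      coeff (addP (scale a f) (scale b f)) i        ∎

    scale-assoc : ∀ a b f → scale a (scale b f) ≈ₚ scale (a * b) f
    scale-assoc a b f = mk≈ₚ λ i → begin
      coeff (scale a (scale b f)) i   ≈⟨ coeff-scale a (scale b f) i ⟩
      a * coeff (scale b f) i         ≈⟨ *-congˡ (coeff-scale b f i) ⟩
      a * (b * coeff f i)             ≈⟨ *-assoc _ _ _ ⟨
      (a * b) * coeff f i             ≈⟨ coeff-scale (a * b) f i ⟨
      coeff (scale (a * b) f) i       ∎

    scale-identity : ∀ f → scale 1# f ≈ₚ f
    scale-identity f = mk≈ₚ λ i → trans (coeff-scale 1# f i) (*-identityˡ _)

    scale-zero : ∀ f → scale 0# f ≈ₚ []
    scale-zero f = mk≈ₚ λ i → trans (coeff-scale 0# f i) (zeroˡ _)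

    shift-cong : ∀ {f g} → f ≈ₚ g → shift f ≈ₚ shift g
    shift-cong = ∷-cong refl

    shift-[] : shift [] ≈ₚ []
    shift-[] = mk≈ₚ λ { zero → refl ; (suc i) → refl }

    shift-addP : ∀ f g → shift (addP f g) ≈ₚ addP (shift f) (shift g)
    shift-addP f g = ∷-cong (sym (+-identityˡ 0#)) ≈ₚ-refl

    scale-shift : ∀ a f → scale a (shift f) ≈ₚ shift (scale a f)
    scale-shift a f = ∷-cong (zeroʳ a) ≈ₚ-refl

    mulP-[]ˡ : ∀ f g → [] ≈ₚ f → mulP f g ≈ₚ []
    mulP-[]ˡ [] g e = ≈ₚ-refl
    mulP-[]ˡ (b ∷ f) g e = ≈ₚ-trans
      (addP-cong (≈ₚ-trans (scale-cong ([]≈∷⇒≈0 e) ≈ₚ-refl) (scale-zero g))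
                 (≈ₚ-trans (shift-cong (mulP-[]ˡ f g ([]≈∷⇒[]≈ e))) shift-[]))
      ≈ₚ-refl

    mulP-[]ʳ : ∀ f → mulP f [] ≈ₚ []
    mulP-[]ʳ [] = ≈ₚ-refl
    mulP-[]ʳ (a ∷ f) = ≈ₚ-trans (shift-cong (mulP-[]ʳ f)) shift-[]

    mulP-congˡ : ∀ {f f′} g → f ≈ₚ f′ → mulP f g ≈ₚ mulP f′ g
    mulP-congˡ {[]} {f′} g e = ≈ₚ-sym (mulP-[]ˡ f′ g e)
    mulP-congˡ {a ∷ f} {[]} g e = mulP-[]ˡ (a ∷ f) g (≈ₚ-sym e)
    mulP-congˡ {a ∷ f} {b ∷ f′} g e =
      addP-cong (scale-cong (∷-injectiveˡ e) ≈ₚ-refl) (shift-cong (mulP-congˡ g (∷-injectiveʳ e)))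

    mulP-congʳ : ∀ f {g g′} → g ≈ₚ g′ → mulP f g ≈ₚ mulP f g′
    mulP-congʳ [] e = ≈ₚ-refl
    mulP-congʳ (a ∷ f) e = addP-cong (scale-cong refl e) (shift-cong (mulP-congʳ f e))

    mulP-cong : ∀ {f f′ g g′} → f ≈ₚ f′ → g ≈ₚ g′ → mulP f g ≈ₚ mulP f′ g′
    mulP-cong {f} {f′} {g} e e′ = ≈ₚ-trans (mulP-congˡ g e) (mulP-congʳ f′ e′)

    mulP-distribʳ : ∀ h f g → mulP (addP f g) h ≈ₚ addP (mulP f h) (mulP g h)
    mulP-distribʳ h [] g = ≈ₚ-refl
    mulP-distribʳ h (a ∷ f) [] = ≈ₚ-sym (addP-identityʳ _)
    mulP-distribʳ h (a ∷ f) (b ∷ g) = ≈ₚ-trans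
      (addP-cong (scale-distribʳ a b h)
                 (≈ₚ-trans (shift-cong (mulP-distribʳ h f g)) (shift-addP (mulP f h) (mulP g h))))
      (addP-interchange (scale a h) (scale b h) (shift (mulP f h)) (shift (mulP g h)))

    mulP-distribˡ : ∀ h f g → mulP h (addP f g) ≈ₚ addP (mulP h f) (mulP h g)
    mulP-distribˡ [] f g = ≈ₚ-refl
    mulP-distribˡ (c ∷ h) f g = ≈ₚ-trans
      (addP-cong (scale-distribˡ c f g)
                 (≈ₚ-trans (shift-cong (mulP-distribˡ h f g)) (shift-addP (mulP h f) (mulP h g))))
      (addP-interchange (scale c f) (scale c g) (shift (mulP h f)) (shift (mulP h g)))

    mulP-∷ʳ : ∀ f b g → mulP f (b ∷ g) ≈ₚ addP (scale b f) (shift (mulP f g))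
    mulP-∷ʳ [] b g = ≈ₚ-sym shift-[]
    mulP-∷ʳ (a ∷ f) b g = ∷-cong (+-congʳ (*-comm a b))
      (≈ₚ-trans (addP-cong ≈ₚ-refl (mulP-∷ʳ f b g)) (addP-swap (scale a g) (scale b f) (shift (mulP f g))))

    mulP-comm : ∀ f g → mulP f g ≈ₚ mulP g f
    mulP-comm [] g = ≈ₚ-sym (mulP-[]ʳ g)
    mulP-comm (a ∷ f) g = ≈ₚ-trans (addP-cong ≈ₚ-refl (shift-cong (mulP-comm f g))) (≈ₚ-sym (mulP-∷ʳ g a f))

    mulP-scaleˡ : ∀ a f g → mulP (scale a f) g ≈ₚ scale a (mulP f g)
    mulP-scaleˡ a [] g = ≈ₚ-refl
    mulP-scaleˡ a (b ∷ f) g = ≈ₚ-trans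
      (addP-cong (≈ₚ-sym (scale-assoc a b g)) (≈ₚ-trans (shift-cong (mulP-scaleˡ a f g)) (≈ₚ-sym (scale-shift a (mulP f g)))))
      (≈ₚ-sym (scale-distribˡ a (scale b g) (shift (mulP f g))))

    mulP-shiftˡ : ∀ f g → mulP (shift f) g ≈ₚ shift (mulP f g)
    mulP-shiftˡ f g = addP-cong (scale-zero g) ≈ₚ-refl

    mulP-assoc : ∀ f g h → mulP (mulP f g) h ≈ₚ mulP f (mulP g h)
    mulP-assoc [] g h = ≈ₚ-refl
    mulP-assoc (a ∷ f) g h = ≈ₚ-trans (mulP-distribʳ h (scale a g) (shift (mulP f g)))
      (addP-cong (mulP-scaleˡ a g h) (≈ₚ-trans (mulP-shiftˡ (mulP f g) h) (shift-cong (mulP-assoc f g h))))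

    mulP-identityˡ : ∀ g → mulP 1ₚ g ≈ₚ g
    mulP-identityˡ g = ≈ₚ-trans (addP-cong (scale-identity g) shift-[]) (addP-identityʳ g)

    mulP-identityʳ : ∀ g → mulP g 1ₚ ≈ₚ g
    mulP-identityʳ g = ≈ₚ-trans (mulP-comm g 1ₚ) (mulP-identityˡ g)

    constant*≈scale : ∀ a f → mulP (constant a) f ≈ₚ scale a f
    constant*≈scale a f = ≈ₚ-trans (addP-cong (≈ₚ-refl {scale a f}) shift-[]) (addP-identityʳ (scale a f))

    polynomial-isCommutativeRing : IsCommutativeRing _≈ₚ_ addP mulP negate [] 1ₚ
    polynomial-isCommutativeRing = record
      { isRing = record
        { +-isAbelianGroup = record
          { isGroup = record
            { isMonoid = record
              { isSemigroup = record
                { isMagma = record { isEquivalence = ≈ₚ-isEquivalence ; ∙-cong = addP-cong }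
                ; assoc = addP-assoc }
              ; identity = (λ _ → ≈ₚ-refl) , addP-identityʳ }
            ; inverse = addP-inverseˡ , addP-inverseʳ
            ; ⁻¹-cong = negate-cong }
          ; comm = addP-comm }
        ; *-cong = mulP-cong
        ; *-assoc = mulP-assoc
        ; *-identity = mulP-identityˡ , mulP-identityʳ
        ; distrib = mulP-distribˡ , mulP-distribʳ }
      ; *-comm = mulP-comm }

    polynomialRing : CommutativeRing 0ℓ 0ℓ
    polynomialRing = record { isCommutativeRing = polynomial-isCommutativeRing }

    eval : A → Polynomial → A
    eval c = foldr (λ a acc → a + c * acc) 0#

    eval-[] : ∀ c {f} → [] ≈ₚ f → eval c f ≈ 0#
    eval-[] c {[]} e = refl
    eval-[] c {b ∷ f} e = begin
      b + c * eval c f   ≈⟨ +-cong ([]≈∷⇒≈0 e) (*-congˡ (eval-[] c ([]≈∷⇒[]≈ e))) ⟩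
      0# + c * 0#        ≈⟨ +-identityˡ _ ⟩
      c * 0#             ≈⟨ zeroʳ c ⟩
      0#                 ∎

    eval-cong : ∀ c {f g} → f ≈ₚ g → eval c f ≈ eval c g
    eval-cong c {[]} {g} e = sym (eval-[] c e)
    eval-cong c {a ∷ f} {[]} e = eval-[] c (≈ₚ-sym e)
    eval-cong c {a ∷ f} {b ∷ g} e = +-cong (∷-injectiveˡ e) (*-congˡ (eval-cong c (∷-injectiveʳ e)))

    eval-addP : ∀ c f g → eval c (addP f g) ≈ eval c f + eval c g
    eval-addP c [] g = sym (+-identityˡ _)
    eval-addP c (a ∷ f) [] = sym (+-identityʳ _)
    eval-addP c (a ∷ f) (b ∷ g) = begin
      (a + b) + c * eval c (addP f g)             ≈⟨ +-congˡ (*-congˡ (eval-addP c f g)) ⟩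
      (a + b) + c * (eval c f + eval c g)         ≈⟨ +-congˡ (distribˡ c _ _) ⟩
      (a + b) + (c * eval c f + c * eval c g)     ≈⟨ +-interchange _ _ _ _ ⟩
      (a + c * eval c f) + (b + c * eval c g)     ∎

    eval-scale : ∀ c a f → eval c (scale a f) ≈ a * eval c f
    eval-scale c a [] = sym (zeroʳ a)
    eval-scale c a (b ∷ f) = begin
      a * b + c * eval c (scale a f)   ≈⟨ +-congˡ (*-congˡ (eval-scale c a f)) ⟩
      a * b + c * (a * eval c f)       ≈⟨ +-congˡ (x∙yz≈y∙xz c a _) ⟩
      a * b + a * (c * eval c f)       ≈⟨ distribˡ a _ _ ⟨
      a * (b + c * eval c f)           ∎

    eval-mulP : ∀ c f g → eval c (mulP f g) ≈ eval c f * eval c g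
    eval-mulP c [] g = sym (zeroˡ _)
    eval-mulP c (a ∷ f) g = begin
      eval c (addP (scale a g) (shift (mulP f g)))          ≈⟨ eval-addP c (scale a g) (shift (mulP f g)) ⟩
      eval c (scale a g) + (0# + c * eval c (mulP f g))     ≈⟨ +-cong (eval-scale c a g) (+-identityˡ _) ⟩
      a * eval c g + c * eval c (mulP f g)                  ≈⟨ +-congˡ (*-congˡ (eval-mulP c f g)) ⟩
      a * eval c g + c * (eval c f * eval c g)              ≈⟨ +-congˡ (*-assoc c _ _) ⟨
      a * eval c g + (c * eval c f) * eval c g              ≈⟨ distribʳ (eval c g) a _ ⟨
      (a + c * eval c f) * eval c g                         ∎

    eval-1ₚ : ∀ c → eval c 1ₚ ≈ 1#
    eval-1ₚ c = trans (+-congˡ (zeroʳ c)) (+-identityʳ 1#)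

    eval-negate : ∀ c f → eval c (negate f) ≈ - eval c f
    eval-negate c [] = sym -0#≈0#
    eval-negate c (a ∷ f) = begin
      - a + c * eval c (negate f)   ≈⟨ +-congˡ (*-congˡ (eval-negate c f)) ⟩
      - a + c * - eval c f          ≈⟨ +-congˡ (-‿distribʳ-* c (eval c f)) ⟨
      - a + - (c * eval c f)        ≈⟨ ⁻¹-∙-comm a (c * eval c f) ⟩
      - (a + c * eval c f)          ∎

    eval-isRingHomomorphism : ∀ c → IsRingHomomorphism (CommutativeRing.rawRing polynomialRing) rawRing (eval c)
    eval-isRingHomomorphism c = record
      { isSemiringHomomorphism = record
        { isNearSemiringHomomorphism = record
          { +-isMonoidHomomorphism = record
            { isMagmaHomomorphism = record { isRelHomomorphism = record { cong = eval-cong c } ; homo = eval-addP c }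
            ; ε-homo = refl }
          ; *-homo = eval-mulP c }
        ; 1#-homo = eval-1ₚ c }
      ; -‿homo = eval-negate c }

  module FormalDerivative (R : CommutativeRing 0ℓ 0ℓ) where

    open ListPolynomial R
    open CommutativeRing polynomialRing using (setoid)
    open import Relation.Binary.Reasoning.Setoid setoid
    open RingSolver (fromCommutativeRing polynomialRing (λ _ → nothing)) using (solve; _⊜_; _⊕_)

    D : Polynomial → Polynomial
    D [] = []
    D (a ∷ f) = addP f (shift (D f))

    D-[] : ∀ {f} → [] ≈ₚ f → [] ≈ₚ D f
    D-[] {[]} e = ≈ₚ-refl
    D-[] {b ∷ f} e = addP-cong ([]≈∷⇒[]≈ e) (≈ₚ-trans (≈ₚ-sym shift-[]) (shift-cong (D-[] ([]≈∷⇒[]≈ e))))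

    D-cong : ∀ {f g} → f ≈ₚ g → D f ≈ₚ D g
    D-cong {[]} {g} e = D-[] e
    D-cong {a ∷ f} {[]} e = ≈ₚ-sym (D-[] (≈ₚ-sym e))
    D-cong {a ∷ f} {b ∷ g} e = addP-cong (∷-injectiveʳ e) (shift-cong (D-cong (∷-injectiveʳ e)))

    D-addP : ∀ f g → D (addP f g) ≈ₚ addP (D f) (D g)
    D-addP [] g = ≈ₚ-refl
    D-addP (a ∷ f) [] = ≈ₚ-sym (addP-identityʳ _)
    D-addP (a ∷ f) (b ∷ g) = ≈ₚ-trans
      (addP-cong ≈ₚ-refl (≈ₚ-trans (shift-cong (D-addP f g)) (shift-addP (D f) (D g))))
      (addP-interchange f g (shift (D f)) (shift (D g)))

    D-scale : ∀ a f → D (scale a f) ≈ₚ scale a (D f)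
    D-scale a [] = ≈ₚ-refl
    D-scale a (b ∷ f) = ≈ₚ-trans
      (addP-cong ≈ₚ-refl (≈ₚ-trans (shift-cong (D-scale a f)) (≈ₚ-sym (scale-shift a (D f)))))
      (≈ₚ-sym (scale-distribˡ a f (shift (D f))))

    D-mulP : ∀ f g → D (mulP f g) ≈ₚ addP (mulP (D f) g) (mulP f (D g))
    D-mulP [] g = ≈ₚ-refl
    D-mulP (a ∷ f) g = begin
      D (addP (scale a g) (shift (mulP f g)))
        ≈⟨ D-addP (scale a g) (shift (mulP f g)) ⟩
      addP (D (scale a g)) (addP (mulP f g) (shift (D (mulP f g))))
        ≈⟨ addP-cong (D-scale a g) (addP-cong ≈ₚ-refl (shift-cong (D-mulP f g))) ⟩
      addP (scale a (D g)) (addP (mulP f g) (shift (addP (mulP (D f) g) (mulP f (D g)))))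
        ≈⟨ addP-cong (≈ₚ-refl {s}) (addP-cong (≈ₚ-refl {u}) (shift-addP (mulP (D f) g) (mulP f (D g)))) ⟩
      addP s (addP u (addP x y))
        ≈⟨ solve 4 (λ s u x y → (s ⊕ (u ⊕ (x ⊕ y))) ⊜ ((u ⊕ x) ⊕ (s ⊕ y))) ≈ₚ-refl s u x y ⟩
      addP (addP u x) (addP s y)
        ≈⟨ addP-cong (addP-cong (≈ₚ-refl {mulP f g}) (mulP-shiftˡ (D f) g)) (≈ₚ-refl {addP s y}) ⟨
      addP (addP (mulP f g) (mulP (shift (D f)) g)) (mulP (a ∷ f) (D g))
        ≈⟨ addP-cong (mulP-distribʳ g f (shift (D f))) (≈ₚ-refl {addP s y}) ⟨
      addP (mulP (addP f (shift (D f))) g) (mulP (a ∷ f) (D g))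
        ∎
      where
      s = scale a (D g)
      u = mulP f g
      x = shift (mulP (D f) g)
      y = shift (mulP f (D g))

  record IsDerivation (R : CommutativeRing 0ℓ 0ℓ) (δ : CommutativeRing.Carrier R → CommutativeRing.Carrier R) : Set where
    open CommutativeRing R
    field
      cong : ∀ {a b} → a ≈ b → δ a ≈ δ b
      +-homo : ∀ a b → δ (a + b) ≈ δ a + δ b
      leibniz : ∀ a b → δ (a * b) ≈ δ a * b + a * δ b

    0#-homo : δ 0# ≈ 0#
    0#-homo = identityˡ-unique (δ 0#) (δ 0#) (sym (trans (cong (sym (+-identityˡ 0#))) (+-homo 0# 0#)))
      where open import Algebra.Properties.Group +-group using (identityˡ-unique)

  module CoefficientwiseDerivation (R : CommutativeRing 0ℓ 0ℓ)
    (δ : CommutativeRing.Carrier R → CommutativeRing.Carrier R) (δ-isDerivation : IsDerivation R δ) where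

    open CommutativeRing R
    open IsDerivation δ-isDerivation renaming (cong to δ-cong; +-homo to δ-+; leibniz to δ-*; 0#-homo to δ-0#)
    open ListPolynomial R
    open import Relation.Binary.Reasoning.Setoid setoid

    coeff-map : ∀ f i → coeff (map δ f) i ≈ δ (coeff f i)
    coeff-map [] i = sym δ-0#
    coeff-map (a ∷ f) zero = refl
    coeff-map (a ∷ f) (suc i) = coeff-map f i

    map-cong : ∀ {f g} → f ≈ₚ g → map δ f ≈ₚ map δ g
    map-cong {f} {g} e = mk≈ₚ λ i → begin
      coeff (map δ f) i   ≈⟨ coeff-map f i ⟩
      δ (coeff f i)       ≈⟨ δ-cong (coeff-≈ e i) ⟩
      δ (coeff g i)       ≈⟨ coeff-map g i ⟨
      coeff (map δ g) i   ∎

    map-addP : ∀ f g → map δ (addP f g) ≈ₚ addP (map δ f) (map δ g)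
    map-addP f g = mk≈ₚ λ i → begin
      coeff (map δ (addP f g)) i                   ≈⟨ coeff-map (addP f g) i ⟩
      δ (coeff (addP f g) i)                       ≈⟨ δ-cong (coeff-addP f g i) ⟩
      δ (coeff f i + coeff g i)                    ≈⟨ δ-+ _ _ ⟩
      δ (coeff f i) + δ (coeff g i)                ≈⟨ +-cong (coeff-map f i) (coeff-map g i) ⟨
      coeff (map δ f) i + coeff (map δ g) i        ≈⟨ coeff-addP (map δ f) (map δ g) i ⟨
      coeff (addP (map δ f) (map δ g)) i           ∎

    map-scale : ∀ a f → map δ (scale a f) ≈ₚ addP (scale (δ a) f) (scale a (map δ f))
    map-scale a f = mk≈ₚ λ i → begin
      coeff (map δ (scale a f)) i
        ≈⟨ coeff-map (scale a f) i ⟩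
      δ (coeff (scale a f) i)
        ≈⟨ δ-cong (coeff-scale a f i) ⟩
      δ (a * coeff f i)
        ≈⟨ δ-* a (coeff f i) ⟩
      δ a * coeff f i + a * δ (coeff f i)
        ≈⟨ +-cong (coeff-scale (δ a) f i) (trans (coeff-scale a (map δ f) i) (*-congˡ (coeff-map f i))) ⟨
      coeff (scale (δ a) f) i + coeff (scale a (map δ f)) i
        ≈⟨ coeff-addP (scale (δ a) f) (scale a (map δ f)) i ⟨
      coeff (addP (scale (δ a) f) (scale a (map δ f))) i
        ∎

    map-mulP : ∀ f g → map δ (mulP f g) ≈ₚ addP (mulP (map δ f) g) (mulP f (map δ g))
    map-mulP [] g = ≈ₚ-refl
    map-mulP (a ∷ f) g = ≈ₚ-trans (map-addP (scale a g) (shift (mulP f g)))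
      (≈ₚ-trans (addP-cong (map-scale a g)
                           (≈ₚ-trans (∷-cong δ-0# (map-mulP f g)) (shift-addP (mulP (map δ f) g) (mulP f (map δ g)))))
                (addP-interchange (scale (δ a) g) (scale a (map δ g)) (shift (mulP (map δ f) g)) (shift (mulP f (map δ g)))))

  module CoefficientwiseHomomorphism (R S : CommutativeRing 0ℓ 0ℓ)
    (φ : CommutativeRing.Carrier R → CommutativeRing.Carrier S)
    (φ-isRingHomomorphism : IsRingHomomorphism (CommutativeRing.rawRing R) (CommutativeRing.rawRing S) φ) where

    open CommutativeRing R using () renaming (_+_ to _+ᴿ_; _*_ to _*ᴿ_)
    open CommutativeRing S
    open IsRingHomomorphism φ-isRingHomomorphism
      renaming (⟦⟧-cong to φ-cong; +-homo to φ-+; *-homo to φ-*; 0#-homo to φ-0#; 1#-homo to φ-1#)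
    private
      module Rₚ = ListPolynomial R
    open ListPolynomial S
    open import Relation.Binary.Reasoning.Setoid setoid

    coeff-map : ∀ f i → coeff (map φ f) i ≈ φ (Rₚ.coeff f i)
    coeff-map [] i = sym φ-0#
    coeff-map (a ∷ f) zero = refl
    coeff-map (a ∷ f) (suc i) = coeff-map f i

    map-cong : ∀ {f g} → f Rₚ.≈ₚ g → map φ f ≈ₚ map φ g
    map-cong {f} {g} e = mk≈ₚ λ i → begin
      coeff (map φ f) i      ≈⟨ coeff-map f i ⟩
      φ (Rₚ.coeff f i)       ≈⟨ φ-cong (Rₚ.coeff-≈ e i) ⟩
      φ (Rₚ.coeff g i)       ≈⟨ coeff-map g i ⟨
      coeff (map φ g) i      ∎

    map-addP : ∀ f g → map φ (Rₚ.addP f g) ≈ₚ addP (map φ f) (map φ g)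
    map-addP f g = mk≈ₚ λ i → begin
      coeff (map φ (Rₚ.addP f g)) i                ≈⟨ coeff-map (Rₚ.addP f g) i ⟩
      φ (Rₚ.coeff (Rₚ.addP f g) i)                 ≈⟨ φ-cong (Rₚ.coeff-addP f g i) ⟩
      φ (Rₚ.coeff f i +ᴿ Rₚ.coeff g i)             ≈⟨ φ-+ _ _ ⟩
      φ (Rₚ.coeff f i) + φ (Rₚ.coeff g i)          ≈⟨ +-cong (coeff-map f i) (coeff-map g i) ⟨
      coeff (map φ f) i + coeff (map φ g) i        ≈⟨ coeff-addP (map φ f) (map φ g) i ⟨
      coeff (addP (map φ f) (map φ g)) i           ∎

    map-scale : ∀ a f → map φ (Rₚ.scale a f) ≈ₚ scale (φ a) (map φ f)
    map-scale a f = mk≈ₚ λ i → begin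
      coeff (map φ (Rₚ.scale a f)) i     ≈⟨ coeff-map (Rₚ.scale a f) i ⟩
      φ (Rₚ.coeff (Rₚ.scale a f) i)      ≈⟨ φ-cong (Rₚ.coeff-scale a f i) ⟩
      φ (a *ᴿ Rₚ.coeff f i)              ≈⟨ φ-* _ _ ⟩
      φ a * φ (Rₚ.coeff f i)             ≈⟨ *-congˡ (coeff-map f i) ⟨
      φ a * coeff (map φ f) i            ≈⟨ coeff-scale (φ a) (map φ f) i ⟨
      coeff (scale (φ a) (map φ f)) i    ∎

    map-mulP : ∀ f g → map φ (Rₚ.mulP f g) ≈ₚ mulP (map φ f) (map φ g)
    map-mulP [] g = ≈ₚ-refl
    map-mulP (a ∷ f) g = ≈ₚ-trans (map-addP (Rₚ.scale a g) (Rₚ.shift (Rₚ.mulP f g)))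
      (addP-cong (map-scale a g) (∷-cong φ-0# (map-mulP f g)))

    map-powP : ∀ f e → map φ (Rₚ.powP f e) ≈ₚ powP (map φ f) e
    map-powP f zero = ∷-cong φ-1# ≈ₚ-refl
    map-powP f (suc e) = ≈ₚ-trans (map-mulP f (Rₚ.powP f e)) (mulP-congʳ (map φ f) (map-powP f e))


module FermatsLittleTheorem where

  open import Data.Nat
  open import Data.Nat.Properties
  open import Data.Nat.Divisibility using (_∣_; divides; ∣⇒≤)
  open import Data.Nat.Primality using (Prime; euclidsLemma)
  open import Data.Nat.Tactic.RingSolver using (solve-∀)
  open import Data.Product using (∃; _,_)
  open import Data.Sum using (inj₁; inj₂)
  open import Data.Empty using (⊥-elim)
  open import Relation.Binary.PropositionalEquality
  open ≡-Reasoning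

  -- Pascal's recursion; the library's _C_ goes through factorials and does not compute on open terms
  binomial : ℕ → ℕ → ℕ
  binomial n zero = 1
  binomial zero (suc k) = 0
  binomial (suc n) (suc k) = binomial n k + binomial n (suc k)

  binomial-vanishes : ∀ n k → binomial n (suc n + k) ≡ 0
  binomial-vanishes zero k = refl
  binomial-vanishes (suc n) k = cong₂ _+_ (binomial-vanishes n k)
    (trans (cong (binomial n) (sym (+-suc (suc n) k))) (binomial-vanishes n (suc k)))

  binomial-above : ∀ n → binomial n (suc n) ≡ 0
  binomial-above n = trans (cong (binomial n) (sym (+-identityʳ (suc n)))) (binomial-vanishes n 0)

  binomial-diagonal : ∀ n → binomial n n ≡ 1
  binomial-diagonal zero = refl
  binomial-diagonal (suc n) = cong₂ _+_ (binomial-diagonal n) (binomial-above n)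

  binomial-absorption : ∀ n k → suc k * binomial (suc n) (suc k) ≡ suc n * binomial n k
  binomial-absorption zero zero = refl
  binomial-absorption zero (suc k) = *-zeroʳ (suc (suc k))
  binomial-absorption (suc n) zero = begin
    1 * (1 + binomial (suc n) 1)       ≡⟨ cong (λ x → 1 * (1 + x)) (sym (*-identityˡ (binomial (suc n) 1))) ⟩
    1 * (1 + 1 * binomial (suc n) 1)   ≡⟨ cong (λ x → 1 * (1 + x)) (binomial-absorption n 0) ⟩
    1 * (1 + suc n * 1)                ≡⟨ identity n ⟩
    suc (suc n) * 1                    ∎
    where identity : ∀ n → 1 * (1 + suc n * 1) ≡ suc (suc n) * 1
          identity = solve-∀
  binomial-absorption (suc n) (suc k) = begin
    suc (suc k) * (B (suc n) (suc k) + B (suc n) (suc (suc k)))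
      ≡⟨ *-distribˡ-+ (suc (suc k)) (B (suc n) (suc k)) (B (suc n) (suc (suc k))) ⟩
    suc (suc k) * B (suc n) (suc k) + suc (suc k) * B (suc n) (suc (suc k))
      ≡⟨ cong (suc (suc k) * B (suc n) (suc k) +_) (binomial-absorption n (suc k)) ⟩
    suc (suc k) * B (suc n) (suc k) + suc n * B n (suc k)
      ≡⟨ cong (_+ suc n * B n (suc k)) (identity₁ (suc k) (B (suc n) (suc k))) ⟩
    (suc k * B (suc n) (suc k) + B (suc n) (suc k)) + suc n * B n (suc k)
      ≡⟨ cong (λ x → (x + B (suc n) (suc k)) + suc n * B n (suc k)) (binomial-absorption n k) ⟩
    (suc n * B n k + (B n k + B n (suc k))) + suc n * B n (suc k)
      ≡⟨ identity₂ n (B n k) (B n (suc k)) ⟩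
    suc (suc n) * (B n k + B n (suc k)) ∎
    where
    B = binomial
    identity₁ : ∀ m x → suc m * x ≡ m * x + x
    identity₁ = solve-∀
    identity₂ : ∀ n x y → (suc n * x + (x + y)) + suc n * y ≡ suc (suc n) * (x + y)
    identity₂ = solve-∀

  binomialSum : ℕ → ℕ → ℕ → ℕ
  binomialSum n a zero = 0
  binomialSum n a (suc k) = binomialSum n a k + binomial n k * a ^ k

  binomialSum-pascal : ∀ n a k → binomialSum (suc n) a (suc k) ≡ binomialSum n a (suc k) + a * binomialSum n a k
  binomialSum-pascal n a zero = identity a
    where identity : ∀ a → 0 + 1 * 1 ≡ (0 + 1 * 1) + a * 0
          identity = solve-∀
  binomialSum-pascal n a (suc k) = begin
    binomialSum (suc n) a (suc k) + (binomial n k + binomial n (suc k)) * (a * a ^ k)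
      ≡⟨ cong (_+ (binomial n k + binomial n (suc k)) * (a * a ^ k)) (binomialSum-pascal n a k) ⟩
    (binomialSum n a (suc k) + a * binomialSum n a k) + (binomial n k + binomial n (suc k)) * (a * a ^ k)
      ≡⟨ identity (binomialSum n a (suc k)) (binomialSum n a k) (binomial n k) (binomial n (suc k)) (a ^ k) a ⟩
    (binomialSum n a (suc k) + binomial n (suc k) * (a * a ^ k)) + a * (binomialSum n a k + binomial n k * a ^ k) ∎
    where identity : ∀ X Y u v w a → (X + a * Y) + (u + v) * (a * w) ≡ (X + v * (a * w)) + a * (Y + u * w)
          identity = solve-∀

  binomialTheorem : ∀ n a → (1 + a) ^ n ≡ binomialSum n a (suc n)
  binomialTheorem zero a = refl
  binomialTheorem (suc n) a = begin
    (1 + a) * (1 + a) ^ n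
      ≡⟨ cong ((1 + a) *_) (binomialTheorem n a) ⟩
    (1 + a) * binomialSum n a (suc n)
      ≡⟨ identity (binomialSum n a (suc n)) a (a ^ suc n) ⟩
    (binomialSum n a (suc n) + 0 * a ^ suc n) + a * binomialSum n a (suc n)
      ≡⟨ cong (λ x → (binomialSum n a (suc n) + x * a ^ suc n) + a * binomialSum n a (suc n)) (sym (binomial-above n)) ⟩
    binomialSum n a (suc (suc n)) + a * binomialSum n a (suc n)
      ≡⟨ binomialSum-pascal n a (suc n) ⟨
    binomialSum (suc n) a (suc (suc n)) ∎
    where identity : ∀ X a w → (1 + a) * X ≡ (X + 0 * w) + a * X
          identity = solve-∀

  prime∣binomial : ∀ {q} → Prime (suc q) → ∀ j → suc j < suc q → suc q ∣ binomial (suc q) (suc j)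
  prime∣binomial {q} p-prime j j<q
    with euclidsLemma (suc j) (binomial (suc q) (suc j)) p-prime
           (divides (binomial q j) (trans (binomial-absorption q j) (*-comm (suc q) (binomial q j))))
  ... | inj₁ p∣1+j = ⊥-elim (<⇒≱ j<q (∣⇒≤ p∣1+j))
  ... | inj₂ p∣binomial = p∣binomial

  binomialSum≡1+multiple : ∀ {q} → Prime (suc q) → ∀ a j → j < suc q →
                           ∃ λ M → binomialSum (suc q) a (suc j) ≡ 1 + M * suc q
  binomialSum≡1+multiple p-prime a zero j<p = 0 , refl
  binomialSum≡1+multiple {q} p-prime a (suc j) 1+j<p
    with binomialSum≡1+multiple p-prime a j (<-trans (n<1+n j) 1+j<p) | prime∣binomial p-prime j 1+j<p
  ... | M , eq | divides c eq′ = M + c * a ^ suc j , (begin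
    binomialSum p a (suc j) + binomial p (suc j) * a ^ suc j  ≡⟨ cong₂ (λ x y → x + y * a ^ suc j) eq eq′ ⟩
    (1 + M * p) + (c * p) * a ^ suc j                         ≡⟨ identity M p c (a ^ suc j) ⟩
    1 + (M + c * a ^ suc j) * p                               ∎)
    where p = suc q
          identity : ∀ M p c w → (1 + M * p) + (c * p) * w ≡ 1 + (M + c * w) * p
          identity = solve-∀

  fermat : ∀ {p} → Prime p → ∀ a → ∃ λ M → a ^ p ≡ a + M * p
  fermat {suc q} p-prime zero = 0 , refl
  fermat {suc q} p-prime (suc a) with fermat p-prime a | binomialSum≡1+multiple p-prime a q (n<1+n q)
  ... | M , eq | M′ , eq′ = M′ + M , (begin
    (1 + a) ^ p                                  ≡⟨ binomialTheorem p a ⟩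
    binomialSum p a p + binomial p p * a ^ p     ≡⟨ cong (λ y → binomialSum p a p + y * a ^ p) (binomial-diagonal p) ⟩
    binomialSum p a p + 1 * a ^ p                ≡⟨ cong₂ (λ x y → x + 1 * y) eq′ eq ⟩
    (1 + M′ * p) + 1 * (a + M * p)               ≡⟨ identity M′ M p a ⟩
    suc a + (M′ + M) * p                         ∎)
    where p = suc q
          identity : ∀ M′ M p a → (1 + M′ * p) + 1 * (a + M * p) ≡ suc a + (M′ + M) * p
          identity = solve-∀


module IntegersModulo (p : ℕ) where

  open import Data.Nat as ℕ using (ℕ; zero; suc; NonZero; nonTrivial⇒n>1; _%_; _/_; _≤_; _<_; _∸_)
  open import Data.Nat.Properties as ℕP using (≤-total; m+[n∸m]≡n)
  open import Data.Nat.DivMod using (m≡m%n+[m/n]*n; %-remove-+ʳ; m<n⇒m%n≡m)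
  open import Data.Nat.Divisibility using (∣⇒≤) renaming (_∣_ to _∣ℕ_)
  open import Data.Integer as ℤ using (ℤ; +_; -_; _+_; _*_; _-_)
  import Data.Integer.Properties as ℤP
  open import Data.Integer.Divisibility using (divides) renaming (_∣_ to _∣ᵤ_)
  open import Data.Integer.Divisibility.Signed using (_∣_; ∣ᵤ⇒∣; ∣⇒∣ᵤ; ∣m∣n⇒∣m+n; ∣m⇒∣-m; ∣m⇒∣m*n; ∣n⇒∣m*n)
  open import Data.Integer.Tactic.RingSolver using (solve-∀)
  open import Data.Nat.Primality using (euclidsLemma; prime⇒nonTrivial)
  open import Relation.Nullary using (¬_)
  open import Data.Sum using (_⊎_; inj₁; inj₂; map)
  open import Data.Product using (_,_)
  open import Relation.Binary.PropositionalEquality using (_≡_; refl; subst; sym; trans; cong; cong₂; module ≡-Reasoning)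
  open import Relation.Binary.Structures using (IsEquivalence)
  open import Defs using (_≡_[mod_])
  open FermatsLittleTheorem using (fermat)

  infix 4 _≈_
  record _≈_ (a b : ℤ) : Set where
    constructor mk≈
    field p∣a-b : a ≡ b [mod p ]
  open _≈_ public

  private
    p∣ : ∀ {a b} → a ≈ b → + p ∣ a - b
    p∣ e = ∣ᵤ⇒∣ (p∣a-b e)

    from-p∣ : ∀ {x a b} → x ≡ a - b → + p ∣ x → a ≈ b
    from-p∣ refl p∣x = mk≈ (∣⇒∣ᵤ p∣x)

  ≡⇒≈ : ∀ {a b} → a ≡ b → a ≈ b
  ≡⇒≈ {a} refl = mk≈ (subst (+ p ∣ᵤ_) (sym (ℤP.+-inverseʳ a)) (divides 0 refl))

  ≈-refl : ∀ {a} → a ≈ a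
  ≈-refl = ≡⇒≈ refl

  ≈-sym : ∀ {a b} → a ≈ b → b ≈ a
  ≈-sym {a} {b} e = from-p∣ (identity a b) (∣m⇒∣-m (p∣ e))
    where identity : ∀ a b → - (a - b) ≡ b - a
          identity = solve-∀

  ≈-trans : ∀ {a b c} → a ≈ b → b ≈ c → a ≈ c
  ≈-trans {a} {b} {c} e e′ = from-p∣ (identity a b c) (∣m∣n⇒∣m+n (p∣ e) (p∣ e′))
    where identity : ∀ a b c → (a - b) + (b - c) ≡ a - c
          identity = solve-∀

  +-cong : ∀ {a b c d} → a ≈ b → c ≈ d → a + c ≈ b + d
  +-cong {a} {b} {c} {d} e e′ = from-p∣ (identity a b c d) (∣m∣n⇒∣m+n (p∣ e) (p∣ e′))
    where identity : ∀ a b c d → (a - b) + (c - d) ≡ (a + c) - (b + d)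
          identity = solve-∀

  *-cong : ∀ {a b c d} → a ≈ b → c ≈ d → a * c ≈ b * d
  *-cong {a} {b} {c} {d} e e′ = from-p∣ (identity a b c d) (∣m∣n⇒∣m+n (∣m⇒∣m*n c (p∣ e)) (∣n⇒∣m*n b (p∣ e′)))
    where identity : ∀ a b c d → (a - b) * c + b * (c - d) ≡ a * c - b * d
          identity = solve-∀

  -‿cong : ∀ {a b} → a ≈ b → - a ≈ - b
  -‿cong {a} {b} e = from-p∣ (identity a b) (∣m⇒∣-m (p∣ e))
    where identity : ∀ a b → - (a - b) ≡ - a - - b
          identity = solve-∀

  ℤ/pℤ : CommutativeRing 0ℓ 0ℓ
  ℤ/pℤ = record
    { Carrier = ℤ ; _≈_ = _≈_ ; _+_ = _+_ ; _*_ = _*_ ; -_ = -_ ; 0# = + 0 ; 1# = + 1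
    ; isCommutativeRing = record
      { isRing = record
        { +-isAbelianGroup = record
          { isGroup = record
            { isMonoid = record
              { isSemigroup = record
                { isMagma = record { isEquivalence = isEquivalence ; ∙-cong = +-cong }
                ; assoc = λ a b c → ≡⇒≈ (ℤP.+-assoc a b c) }
              ; identity = (λ a → ≡⇒≈ (ℤP.+-identityˡ a)) , (λ a → ≡⇒≈ (ℤP.+-identityʳ a)) }
            ; inverse = (λ a → ≡⇒≈ (ℤP.+-inverseˡ a)) , (λ a → ≡⇒≈ (ℤP.+-inverseʳ a))
            ; ⁻¹-cong = -‿cong }
          ; comm = λ a b → ≡⇒≈ (ℤP.+-comm a b) }
        ; *-cong = *-cong
        ; *-assoc = λ a b c → ≡⇒≈ (ℤP.*-assoc a b c)
        ; *-identity = (λ a → ≡⇒≈ (ℤP.*-identityˡ a)) , (λ a → ≡⇒≈ (ℤP.*-identityʳ a))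
        ; distrib = (λ a b c → ≡⇒≈ (ℤP.*-distribˡ-+ a b c)) , (λ a b c → ≡⇒≈ (ℤP.*-distribʳ-+ a b c)) }
      ; *-comm = λ a b → ≡⇒≈ (ℤP.*-comm a b) } }
    where
    isEquivalence : IsEquivalence _≈_
    isEquivalence = record { refl = ≈-refl ; sym = ≈-sym ; trans = ≈-trans }

  ≈0⇒p∣ : ∀ {a} → a ≈ + 0 → + p ∣ᵤ a
  ≈0⇒p∣ {a} e = subst (+ p ∣ᵤ_) (ℤP.+-identityʳ a) (p∣a-b e)

  p∣⇒≈0 : ∀ {a} → + p ∣ᵤ a → a ≈ + 0
  p∣⇒≈0 {a} p∣a = mk≈ (subst (+ p ∣ᵤ_) (sym (ℤP.+-identityʳ a)) p∣a)

  a*b≈0⇒a≈0∨b≈0 : Prime p → ∀ a b → a * b ≈ + 0 → a ≈ + 0 ⊎ b ≈ + 0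
  a*b≈0⇒a≈0∨b≈0 p-prime a b ab≈0 = map p∣⇒≈0 p∣⇒≈0
    (euclidsLemma ℤ.∣ a ∣ ℤ.∣ b ∣ p-prime (subst (p ∣ℕ_) (ℤP.abs-* a b) (≈0⇒p∣ ab≈0)))

  1≉0 : Prime p → ¬ (+ 1 ≈ + 0)
  1≉0 p-prime 1≈0 = ℕP.<⇒≱ (nonTrivial⇒n>1 p {{prime⇒nonTrivial p-prime}}) (∣⇒≤ (p∣a-b 1≈0))

  a-b≈0⇒a≈b : ∀ {a b} → a - b ≈ + 0 → a ≈ b
  a-b≈0⇒a≈b e = mk≈ (≈0⇒p∣ e)

  module _ .{{_ : NonZero p}} where

    %≡%⇒≈ : ∀ x y → x % p ≡ y % p → + x ≈ + y
    %≡%⇒≈ x y x%p≡y%p = mk≈ (subst (+ p ∣ᵤ_) (sym x-y≡k*p) (divides ℤ.∣ k ∣ (ℤP.abs-* k (+ p))))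
      where
      k = + (x / p) - + (y / p)
      division : ∀ z → + z ≡ + (z % p) + + (z / p) * + p
      division z = trans (cong +_ (m≡m%n+[m/n]*n z p)) (trans (ℤP.pos-+ (z % p) _) (cong (_+_ (+ (z % p))) (ℤP.pos-* (z / p) p)))
      identity : ∀ r a b c → (r + a * c) - (r + b * c) ≡ (a - b) * c
      identity = solve-∀
      x-y≡k*p : + x - + y ≡ k * + p
      x-y≡k*p = begin
        + x - + y                                                      ≡⟨ cong₂ _-_ (division x) (division y) ⟩
        (+ (x % p) + + (x / p) * + p) - (+ (y % p) + + (y / p) * + p)
          ≡⟨ cong (λ r → (+ (x % p) + + (x / p) * + p) - (+ r + + (y / p) * + p)) x%p≡y%p ⟨
        (+ (x % p) + + (x / p) * + p) - (+ (x % p) + + (y / p) * + p)  ≡⟨ identity (+ (x % p)) (+ (x / p)) (+ (y / p)) (+ p) ⟩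
        k * + p                                                        ∎
        where open ≡-Reasoning

    private
      ∣∸⇒%≡% : ∀ x y → y ≤ x → p ∣ℕ x ∸ y → x % p ≡ y % p
      ∣∸⇒%≡% x y y≤x p∣x∸y = trans (cong (_% p) (sym (m+[n∸m]≡n y≤x))) (%-remove-+ʳ y p∣x∸y)

    ≈⇒%≡% : ∀ x y → + x ≈ + y → x % p ≡ y % p
    ≈⇒%≡% x y x≈y with ≤-total y x
    ... | inj₁ y≤x = ∣∸⇒%≡% x y y≤x
      (subst (p ∣ℕ_) (trans (cong ℤ.∣_∣ (ℤP.m-n≡m⊖n x y)) (trans (ℤP.∣m⊖n∣≡∣n⊖m∣ x y) (ℤP.∣⊖∣-≤ y≤x))) (p∣a-b x≈y))
    ... | inj₂ x≤y = sym (∣∸⇒%≡% y x x≤y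
      (subst (p ∣ℕ_) (trans (cong ℤ.∣_∣ (ℤP.m-n≡m⊖n x y)) (ℤP.∣⊖∣-≤ x≤y)) (p∣a-b x≈y)))

    +≈+⇒≡ : ∀ {i j} → i < p → j < p → + i ≈ + j → i ≡ j
    +≈+⇒≡ i<p j<p i≈j = trans (sym (m<n⇒m%n≡m i<p)) (trans (≈⇒%≡% _ _ i≈j) (m<n⇒m%n≡m j<p))

  fermat-ℤ/pℤ : Prime p → ∀ a → (+ a) ℤ.^ p ≈ + a
  fermat-ℤ/pℤ p-prime a with fermat p-prime a
  ... | M , aᵖ≡a+Mp = ≈-trans (≡⇒≈ (trans (sym (pos-^ a p)) (trans (cong +_ aᵖ≡a+Mp) (ℤP.pos-+ a (M ℕ.* p)))))
                       (≈-trans (+-cong (≈-refl {+ a}) (p∣⇒≈0 {+ (M ℕ.* p)} (divides M refl))) (≡⇒≈ (ℤP.+-identityʳ (+ a))))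
    where
    pos-^ : ∀ a j → + (a ℕ.^ j) ≡ (+ a) ℤ.^ j
    pos-^ a zero = refl
    pos-^ a (suc j) = trans (ℤP.pos-* a (a ℕ.^ j)) (cong (_*_ (+ a)) (pos-^ a j))


module FiniteSums where

  open import Data.Nat
  open import Data.Nat.Properties
  open import Data.Sum using (inj₁; inj₂)
  open import Relation.Binary.PropositionalEquality using (_≡_; refl; cong)

  sumBelow : ℕ → (ℕ → ℕ) → ℕ
  sumBelow zero e = 0
  sumBelow (suc k) e = e k + sumBelow k e

  sumBelow-const : ∀ k c → sumBelow k (λ _ → c) ≡ k * c
  sumBelow-const zero c = refl
  sumBelow-const (suc k) c = cong (c +_) (sumBelow-const k c)

  sumBelow-mono : ∀ K f g → (∀ i → i < K → f i ≤ g i) → sumBelow K f ≤ sumBelow K g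
  sumBelow-mono zero f g _ = z≤n
  sumBelow-mono (suc K) f g f≤g = +-mono-≤ (f≤g K ≤-refl) (sumBelow-mono K f g (λ i i<K → f≤g i (m≤n⇒m≤1+n i<K)))

  sumBelow-mono-< : ∀ K f g → (∀ i → i < K → f i ≤ g i) → ∀ j → j < K → f j < g j → sumBelow K f < sumBelow K g
  sumBelow-mono-< (suc K) f g f≤g j (s≤s j≤K) fj<gj with m≤n⇒m<n∨m≡n j≤K
  ... | inj₁ j<K = +-mono-≤-< (f≤g K ≤-refl) (sumBelow-mono-< K f g (λ i i<K → f≤g i (m≤n⇒m≤1+n i<K)) j j<K fj<gj)
  ... | inj₂ refl = +-mono-<-≤ fj<gj (sumBelow-mono j f g (λ i i<j → f≤g i (m≤n⇒m≤1+n i<j)))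


module LinearFactors {p : ℕ} (p-prime : Prime p) where

  open import Data.Nat as ℕ using (ℕ; zero; suc; _≤_; _<_; _∸_; z≤n; s≤s)
  import Data.Nat.Properties as ℕP
  open import Data.Integer as ℤ using (ℤ; +_; -_; _+_; _*_; _-_)
  import Data.Integer.Properties as ℤP
  open import Data.Integer.Tactic.RingSolver using (solve-∀)
  open import Data.List using ([]; _∷_; length)
  open import Data.Nat.Primality using (prime⇒nonZero; prime⇒nonTrivial)
  open import Data.Product using (_,_; proj₁; proj₂; _×_)
  open import Data.Sum using ([_,_]′)
  open import Relation.Nullary using (¬_; contradiction)
  open import Relation.Binary.PropositionalEquality as ≡ using (_≡_; _≢_)
  import Relation.Binary.Reasoning.Setoid as SetoidReasoning
  open import Defs using (xp-x₁; monoX₁)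
  open Polynomials
  open FiniteSums using (sumBelow; sumBelow-const)

  open IntegersModulo p
  open ListPolynomial ℤ/pℤ
  private
    module 𝔽 = CommutativeRing ℤ/pℤ
    module 𝔽[x] = CommutativeRing polynomialRing
    module ≈-Reasoning = SetoidReasoning 𝔽.setoid
    module ≈ₚ-Reasoning = SetoidReasoning 𝔽[x].setoid
  open import Algebra.Definitions.RawMagma 𝔽[x].*-rawMagma public using (_∣_; _,_)
  open import Algebra.Properties.CommutativeSemiring.Exp 𝔽[x].commutativeSemiring public
    using (_^_; ^-congˡ; ^-homo-*; ^-distrib-*)
  open import Algebra.Properties.Monoid.Divisibility 𝔽[x].*-monoid public
    using (ε∣ʳ_; ∣ʳ-refl; ∣ʳ-reflexive; ∣ʳ-respʳ-≈; ∣ʳ-respˡ-≈; ∣ʳ-trans; x∣ʳy⇒x∣ʳzy)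
  open import Algebra.Properties.CommutativeSemigroup.Divisibility 𝔽[x].*-commutativeSemigroup public
    using (∙-cong-∣; x∣y⇒zx∣zy)
  open import Algebra.Properties.CommutativeSemigroup 𝔽[x].*-commutativeSemigroup using (x∙yz≈y∙xz; x∙yz≈z∙xy; xy∙z≈x∙zy)
  open import Algebra.Properties.Ring 𝔽[x].ring using (-‿distribˡ-*; -‿distribʳ-*)
  open import Algebra.Properties.Group 𝔽[x].+-group using (x∙y⁻¹≈ε⇒x≈y; x≈y⇒x∙y⁻¹≈ε)

  powP≡^ : ∀ f e → powP f e ≡ f ^ e
  powP≡^ f zero = ≡.refl
  powP≡^ f (suc e) = ≡.cong (mulP f) (powP≡^ f e)

  linear : ℤ → Polynomial
  linear c = - c ∷ + 1 ∷ []

  ∣-addP : ∀ {g f f′} → g ∣ f → g ∣ f′ → g ∣ addP f f′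
  ∣-addP {g} {f} {f′} (q , qg≈f) (q′ , q′g≈f′) = addP q q′ , (begin
    mulP (addP q q′) g             ≈⟨ mulP-distribʳ g q q′ ⟩
    addP (mulP q g) (mulP q′ g)    ≈⟨ addP-cong qg≈f q′g≈f′ ⟩
    addP f f′                      ∎)
    where open ≈ₚ-Reasoning

  ∣-negate : ∀ {g f} → g ∣ f → g ∣ negate f
  ∣-negate {g} (q , qg≈f) = negate q , ≈ₚ-trans (≈ₚ-sym (-‿distribˡ-* q g)) (negate-cong qg≈f)

  ^-∣-^ : ∀ f {a b} → b ≤ a → f ^ b ∣ f ^ a
  ^-∣-^ f {a} {b} b≤a = f ^ (a ∸ b) , (begin
    mulP (f ^ (a ∸ b)) (f ^ b)   ≈⟨ ^-homo-* f (a ∸ b) b ⟨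
    f ^ (a ∸ b ℕ.+ b)            ≡⟨ ≡.cong (f ^_) (ℕP.m∸n+n≡m b≤a) ⟩
    f ^ a                        ∎)
    where open ≈ₚ-Reasoning

  nonroot-^ : ∀ c f e → ¬ eval c f ≈ + 0 → ¬ eval c (f ^ e) ≈ + 0
  nonroot-^ c f zero _ 1≈0 = 1≉0 p-prime (𝔽.trans (𝔽.sym (eval-1ₚ c)) 1≈0)
  nonroot-^ c f (suc e) f[c]≉0 fᵉ⁺¹[c]≈0 = [ f[c]≉0 , nonroot-^ c f e f[c]≉0 ]′
    (a*b≈0⇒a≈0∨b≈0 p-prime (eval c f) (eval c (f ^ e)) (𝔽.trans (𝔽.sym (eval-mulP c f (f ^ e))) fᵉ⁺¹[c]≈0))

  eval-linear : ∀ d c → eval d (linear c) ≈ d - c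
  eval-linear d c = ≡⇒≈ (identity d c)
    where identity : ∀ d c → - c + d * (+ 1 + d * + 0) ≡ d - c
          identity = solve-∀

  linear-nonroot : ∀ {i j} → i < p → j < p → i ≢ j → ¬ eval (+ i) (linear (+ j)) ≈ + 0
  linear-nonroot {i} {j} i<p j<p i≢j i-j≈0 =
    i≢j (+≈+⇒≡ {{prime⇒nonZero p-prime}} i<p j<p (a-b≈0⇒a≈b (𝔽.trans (𝔽.sym (eval-linear (+ i) (+ j))) i-j≈0)))

  quotient : ℤ → Polynomial → Polynomial
  quotient c [] = []
  quotient c (a ∷ f) = eval c f ∷ quotient c f

  division-by-linear : ∀ c f → f ≈ₚ addP (mulP (quotient c f) (linear c)) (constant (eval c f))
  division-by-linear c [] = []≈∷ ≈-refl ≈ₚ-refl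
  division-by-linear c (a ∷ f) = ≈ₚ-sym (∷-cong (≡⇒≈ (identity r c a)) (≈ₚ-trans (addP-identityʳ _) remainder))
    where
    r = eval c f
    identity : ∀ r c a → (r * - c + + 0) + (a + c * r) ≡ a
    identity = solve-∀
    remainder : addP (r * + 1 ∷ []) (mulP (quotient c f) (linear c)) ≈ₚ f
    remainder = ≈ₚ-trans (addP-cong (∷-cong (≡⇒≈ (ℤP.*-identityʳ r)) (≈ₚ-refl {[]})) (≈ₚ-refl {mulP (quotient c f) (linear c)}))
                  (≈ₚ-trans (addP-comm (constant r) (mulP (quotient c f) (linear c))) (≈ₚ-sym (division-by-linear c f)))

  root⇒linear∣ : ∀ c f → eval c f ≈ + 0 → linear c ∣ f
  root⇒linear∣ c f f[c]≈0 = q , ≈ₚ-sym (begin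
    f                                              ≈⟨ division-by-linear c f ⟩
    addP (mulP q (linear c)) (constant (eval c f)) ≈⟨ addP-cong (≈ₚ-refl {mulP q (linear c)}) (≈ₚ-sym ([]≈∷ f[c]≈0 ≈ₚ-refl)) ⟩
    addP (mulP q (linear c)) []                    ≈⟨ addP-identityʳ _ ⟩
    mulP q (linear c)                              ∎)
    where open ≈ₚ-Reasoning
          q = quotient c f

  linear∣⇒root : ∀ c f → linear c ∣ f → eval c f ≈ + 0
  linear∣⇒root c f (q , qL≈f) = begin
    eval c f                       ≈⟨ eval-cong c qL≈f ⟨
    eval c (mulP q (linear c))     ≈⟨ eval-mulP c q (linear c) ⟩
    eval c q * eval c (linear c)   ≈⟨ 𝔽.*-congˡ {eval c q} (𝔽.trans (eval-linear c c) (≡⇒≈ (ℤP.+-inverseʳ c))) ⟩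
    eval c q * + 0                 ≈⟨ 𝔽.zeroʳ (eval c q) ⟩
    + 0                            ∎
    where open ≈-Reasoning

  DegreeBelow : Polynomial → ℕ → Set
  DegreeBelow f d = ∀ i → d ≤ i → coeff f i ≈ + 0

  DegreeBelow-cong : ∀ {f g d} → f ≈ₚ g → DegreeBelow f d → DegreeBelow g d
  DegreeBelow-cong f≈g deg i d≤i = 𝔽.trans (𝔽.sym (coeff-≈ f≈g i)) (deg i d≤i)

  DegreeBelow-mono : ∀ {f d d′} → d ≤ d′ → DegreeBelow f d → DegreeBelow f d′
  DegreeBelow-mono d≤d′ deg i d′≤i = deg i (ℕP.≤-trans d≤d′ d′≤i)

  DegreeBelow-length : ∀ f → DegreeBelow f (length f)
  DegreeBelow-length [] i _ = ≈-refl
  DegreeBelow-length (a ∷ f) (suc i) (s≤s le) = DegreeBelow-length f i le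

  ≈[]⇒DegreeBelow : ∀ {f} d → f ≈ₚ [] → DegreeBelow f d
  ≈[]⇒DegreeBelow d f≈[] i _ = coeff-≈ f≈[] i

  DegreeBelow-0⇒≈[] : ∀ {f} → DegreeBelow f 0 → f ≈ₚ []
  DegreeBelow-0⇒≈[] deg = mk≈ₚ λ i → deg i z≤n

  DegreeBelow-1⇒≈constant : ∀ {f} → DegreeBelow f 1 → f ≈ₚ constant (coeff f 0)
  DegreeBelow-1⇒≈constant deg = mk≈ₚ λ { zero → ≈-refl ; (suc i) → deg (suc i) (s≤s z≤n) }

  coeff-linear* : ∀ c h i → coeff (mulP (linear c) h) (suc i) ≈ coeff h i + - c * coeff h (suc i)
  coeff-linear* c h i = begin
    coeff (mulP (linear c) h) (suc i)                     ≈⟨ coeff-addP (scale (- c) h) (shift (mulP 1ₚ h)) (suc i) ⟩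
    coeff (scale (- c) h) (suc i) + coeff (mulP 1ₚ h) i
      ≈⟨ 𝔽.+-cong (coeff-scale (- c) h (suc i)) (coeff-≈ (mulP-identityˡ h) i) ⟩
    - c * coeff h (suc i) + coeff h i                     ≈⟨ 𝔽.+-comm (- c * coeff h (suc i)) (coeff h i) ⟩
    coeff h i + - c * coeff h (suc i)                     ∎
    where open ≈-Reasoning

  DegreeBelow-cancel-linear : ∀ c h d → DegreeBelow (mulP (linear c) h) (suc d) → DegreeBelow h d
  DegreeBelow-cancel-linear c h d deg i d≤i = descend (length h) i d≤i (ℕP.m≤n+m (length h) i)
    where
    recurrence : ∀ i → d ≤ i → coeff h i ≈ c * coeff h (suc i)
    recurrence i d≤i = begin
      coeff h i                                                         ≈⟨ ≡⇒≈ (identity (coeff h i) (coeff h (suc i)) c) ⟩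
      (coeff h i + - c * coeff h (suc i)) + c * coeff h (suc i)
        ≈⟨ 𝔽.+-congʳ (𝔽.trans (𝔽.sym (coeff-linear* c h i)) (deg (suc i) (s≤s d≤i))) ⟩
      + 0 + c * coeff h (suc i)                                         ≈⟨ 𝔽.+-identityˡ _ ⟩
      c * coeff h (suc i)                                               ∎
      where open ≈-Reasoning
            identity : ∀ x y c → x ≡ (x + - c * y) + c * y
            identity = solve-∀
    -- beyond the length of h its coefficients vanish; below, the recurrence propagates downwards
    descend : ∀ t i → d ≤ i → length h ≤ i ℕ.+ t → coeff h i ≈ + 0
    descend zero i d≤i le = DegreeBelow-length h i (≡.subst (length h ≤_) (ℕP.+-identityʳ i) le)
    descend (suc t) i d≤i le = 𝔽.trans (recurrence i d≤i)
      (𝔽.trans (𝔽.*-congˡ {c} (descend t (suc i) (ℕP.m≤n⇒m≤1+n d≤i) (≡.subst (length h ≤_) (ℕP.+-suc i t) le))) (𝔽.zeroʳ c))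

  DegreeBelow-cancel-linear^ : ∀ c e h d → DegreeBelow (mulP (linear c ^ e) h) (e ℕ.+ d) → DegreeBelow h d
  DegreeBelow-cancel-linear^ c zero h d deg = DegreeBelow-cong (mulP-identityˡ h) deg
  DegreeBelow-cancel-linear^ c (suc e) h d deg = DegreeBelow-cancel-linear^ c e h d
    (DegreeBelow-cancel-linear c (mulP (linear c ^ e) h) (e ℕ.+ d)
      (DegreeBelow-cong (mulP-assoc (linear c) (linear c ^ e) h) deg))

  linear-cancelˡ : ∀ c {h h′} → mulP (linear c) h ≈ₚ mulP (linear c) h′ → h ≈ₚ h′
  linear-cancelˡ c {h} {h′} Lh≈Lh′ =
    x∙y⁻¹≈ε⇒x≈y h h′ (DegreeBelow-0⇒≈[] (DegreeBelow-cancel-linear c (addP h (negate h′)) 0 (≈[]⇒DegreeBelow 1 L[h-h′]≈[])))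
    where
    L[h-h′]≈[] : mulP (linear c) (addP h (negate h′)) ≈ₚ []
    L[h-h′]≈[] = begin
      mulP (linear c) (addP h (negate h′))                      ≈⟨ mulP-distribˡ (linear c) h (negate h′) ⟩
      addP (mulP (linear c) h) (mulP (linear c) (negate h′))    ≈⟨ addP-cong Lh≈Lh′ (≈ₚ-sym (-‿distribʳ-* (linear c) h′)) ⟩
      addP (mulP (linear c) h′) (negate (mulP (linear c) h′))   ≈⟨ x≈y⇒x∙y⁻¹≈ε (≈ₚ-refl {mulP (linear c) h′}) ⟩
      []                                                        ∎
      where open ≈ₚ-Reasoning

  linear^-cancelˡ : ∀ c k {h h′} → mulP (linear c ^ k) h ≈ₚ mulP (linear c ^ k) h′ → h ≈ₚ h′
  linear^-cancelˡ c zero {h} {h′} e = ≈ₚ-trans (≈ₚ-sym (mulP-identityˡ h)) (≈ₚ-trans e (mulP-identityˡ h′))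
  linear^-cancelˡ c (suc k) {h} {h′} e = linear^-cancelˡ c k (linear-cancelˡ c
    (≈ₚ-trans (≈ₚ-sym (mulP-assoc (linear c) (linear c ^ k) h)) (≈ₚ-trans e (mulP-assoc (linear c) (linear c ^ k) h′))))

  linear∣-cancel-nonroot : ∀ d g h → ¬ eval d g ≈ + 0 → linear d ∣ mulP g h → linear d ∣ h
  linear∣-cancel-nonroot d g h g[d]≉0 L∣gh =
    [ (λ g[d]≈0 → contradiction g[d]≈0 g[d]≉0) , root⇒linear∣ d h ]′
      (a*b≈0⇒a≈0∨b≈0 p-prime (eval d g) (eval d h) (𝔽.trans (𝔽.sym (eval-mulP d g h)) (linear∣⇒root d (mulP g h) L∣gh)))

  ∣-cancel-nonroot : ∀ d g h e → ¬ eval d g ≈ + 0 → linear d ^ e ∣ mulP g h → linear d ^ e ∣ h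
  ∣-cancel-nonroot d g h zero _ _ = ε∣ʳ h
  ∣-cancel-nonroot d g h (suc e) g[d]≉0 (q , qLᵉ⁺¹≈gh) = divides (linear∣-cancel-nonroot d g h g[d]≉0 L∣gh)
    where
    L = linear d
    L∣gh : L ∣ mulP g h
    L∣gh = ∣ʳ-respʳ-≈ qLᵉ⁺¹≈gh (mulP q (L ^ e) , xy∙z≈x∙zy q (L ^ e) L)
    divides : L ∣ h → L ^ suc e ∣ h
    divides (h₁ , h₁L≈h) = ∣ʳ-respʳ-≈ h₁L≈h (∣ʳ-respˡ-≈ (mulP-comm (L ^ e) L) (∙-cong-∣ Lᵉ∣h₁ (∣ʳ-refl {L})))
      where
      L[qLᵉ]≈L[gh₁] : mulP L (mulP q (L ^ e)) ≈ₚ mulP L (mulP g h₁)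
      L[qLᵉ]≈L[gh₁] = begin
        mulP L (mulP q (L ^ e))    ≈⟨ x∙yz≈y∙xz L q (L ^ e) ⟩
        mulP q (mulP L (L ^ e))    ≈⟨ qLᵉ⁺¹≈gh ⟩
        mulP g h                   ≈⟨ mulP-congʳ g h₁L≈h ⟨
        mulP g (mulP h₁ L)         ≈⟨ x∙yz≈z∙xy g h₁ L ⟩
        mulP L (mulP g h₁)         ∎
        where open ≈ₚ-Reasoning
      Lᵉ∣h₁ : L ^ e ∣ h₁
      Lᵉ∣h₁ = ∣-cancel-nonroot d g h₁ e g[d]≉0 (q , linear-cancelˡ d L[qLᵉ]≈L[gh₁])

  ∣-cancel-linear^ : ∀ c k r {f} → linear c ^ (k ℕ.+ r) ∣ mulP (linear c ^ k) f → linear c ^ r ∣ f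
  ∣-cancel-linear^ c k r {f} (q , qLᵏ⁺ʳ≈Lᵏf) = q , linear^-cancelˡ c k (begin
    mulP (L ^ k) (mulP q (L ^ r))   ≈⟨ x∙yz≈y∙xz (L ^ k) q (L ^ r) ⟩
    mulP q (mulP (L ^ k) (L ^ r))   ≈⟨ mulP-congʳ q (^-homo-* L k r) ⟨
    mulP q (L ^ (k ℕ.+ r))          ≈⟨ qLᵏ⁺ʳ≈Lᵏf ⟩
    mulP (L ^ k) f                  ∎)
    where open ≈ₚ-Reasoning
          L = linear c

  rootProduct : ℕ → (ℕ → ℕ) → Polynomial
  rootProduct zero e = 1ₚ
  rootProduct (suc k) e = mulP (linear (+ k) ^ e k) (rootProduct k e)

  rootProduct-∣ : ∀ k e g → k ≤ p → (∀ i → i < k → linear (+ i) ^ e i ∣ g) → rootProduct k e ∣ g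
  rootProduct-∣ zero e g _ _ = ε∣ʳ g
  rootProduct-∣ (suc k) e g k<p divisors = combine (divisors k ℕP.≤-refl)
    where
    Lᵏ = linear (+ k) ^ e k
    combine : Lᵏ ∣ g → rootProduct (suc k) e ∣ g
    combine (h , hLᵏ≈g) = ∣ʳ-respʳ-≈ (≈ₚ-trans (mulP-comm Lᵏ h) hLᵏ≈g)
      (x∣y⇒zx∣zy Lᵏ (rootProduct-∣ k e h (ℕP.<⇒≤ k<p) divides-h))
      where
      divides-h : ∀ i → i < k → linear (+ i) ^ e i ∣ h
      divides-h i i<k = ∣-cancel-nonroot (+ i) Lᵏ h (e i)
        (nonroot-^ (+ i) (linear (+ k)) (e k) (linear-nonroot (ℕP.<-trans i<k k<p) k<p (ℕP.<⇒≢ i<k)))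
        (∣ʳ-respʳ-≈ (≈ₚ-trans (≈ₚ-sym hLᵏ≈g) (mulP-comm h Lᵏ)) (divisors i (ℕP.m≤n⇒m≤1+n i<k)))

  DegreeBelow-cancel-rootProduct : ∀ k e h d → DegreeBelow (mulP (rootProduct k e) h) (sumBelow k e ℕ.+ d) → DegreeBelow h d
  DegreeBelow-cancel-rootProduct zero e h d deg = DegreeBelow-cong (mulP-identityˡ h) deg
  DegreeBelow-cancel-rootProduct (suc k) e h d deg = DegreeBelow-cancel-rootProduct k e h d
    (DegreeBelow-cancel-linear^ (+ k) (e k) (mulP (rootProduct k e) h) (sumBelow k e ℕ.+ d)
      (≡.subst (DegreeBelow (mulP (linear (+ k) ^ e k) (mulP (rootProduct k e) h))) (ℕP.+-assoc (e k) (sumBelow k e) d)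
        (DegreeBelow-cong (mulP-assoc (linear (+ k) ^ e k) (rootProduct k e) h) deg)))

  many-roots⇒≈[] : ∀ k e g → k ≤ p → (∀ i → i < k → linear (+ i) ^ e i ∣ g) → DegreeBelow g (sumBelow k e) → g ≈ₚ []
  many-roots⇒≈[] k e g k≤p divisors deg = vanishes (rootProduct-∣ k e g k≤p divisors)
    where
    P = rootProduct k e
    vanishes : P ∣ g → g ≈ₚ []
    vanishes (h , hP≈g) = ≈ₚ-trans (≈ₚ-sym hP≈g) (mulP-congˡ P h≈[])
      where
      h≈[] : h ≈ₚ []
      h≈[] = DegreeBelow-0⇒≈[] (DegreeBelow-cancel-rootProduct k e h 0
        (≡.subst (DegreeBelow (mulP P h)) (≡.sym (ℕP.+-identityʳ (sumBelow k e)))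
          (DegreeBelow-cong (≈ₚ-trans (≈ₚ-sym hP≈g) (mulP-comm h P)) deg)))

  Monic : Polynomial → ℕ → Set
  Monic f d = coeff f d ≈ + 1 × DegreeBelow f (suc d)

  Monic-cong : ∀ {f g d} → f ≈ₚ g → Monic f d → Monic g d
  Monic-cong {d = d} f≈g (leading , deg) = 𝔽.trans (𝔽.sym (coeff-≈ f≈g d)) leading , DegreeBelow-cong f≈g deg

  Monic-linear* : ∀ c {f d} → Monic f d → Monic (mulP (linear c) f) (suc d)
  Monic-linear* c {f} {d} (leading , deg) = leading′ , deg′
    where
    vanishing : ∀ {i} → suc d ≤ i → - c * coeff f i ≈ + 0
    vanishing d<i = 𝔽.trans (𝔽.*-congˡ { - c} (deg _ d<i)) (𝔽.zeroʳ (- c))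
    leading′ : coeff (mulP (linear c) f) (suc d) ≈ + 1
    leading′ = 𝔽.trans (coeff-linear* c f d) (𝔽.trans (𝔽.+-cong leading (vanishing ℕP.≤-refl)) (𝔽.+-identityʳ (+ 1)))
    deg′ : DegreeBelow (mulP (linear c) f) (suc (suc d))
    deg′ (suc i) (s≤s d<i) = 𝔽.trans (coeff-linear* c f i)
      (𝔽.trans (𝔽.+-cong (deg i d<i) (vanishing (ℕP.m≤n⇒m≤1+n d<i))) (𝔽.+-identityʳ (+ 0)))

  Monic-linear^* : ∀ c e {f d} → Monic f d → Monic (mulP (linear c ^ e) f) (e ℕ.+ d)
  Monic-linear^* c zero {f} monic = Monic-cong (≈ₚ-sym (mulP-identityˡ f)) monic
  Monic-linear^* c (suc e) {f} {d} monic = Monic-cong {d = suc e ℕ.+ d} (≈ₚ-sym (mulP-assoc (linear c) (linear c ^ e) f))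
    (Monic-linear* c {mulP (linear c ^ e) f} {e ℕ.+ d} (Monic-linear^* c e {f} {d} monic))

  rootProduct-monic : ∀ k e → Monic (rootProduct k e) (sumBelow k e)
  rootProduct-monic zero e = ≈-refl , λ { (suc i) _ → ≈-refl }
  rootProduct-monic (suc k) e = Monic-linear^* (+ k) (e k) (rootProduct-monic k e)

  1ₚ^ : ∀ e → 1ₚ ^ e ≈ₚ 1ₚ
  1ₚ^ zero = ≈ₚ-refl
  1ₚ^ (suc e) = ≈ₚ-trans (mulP-identityˡ (1ₚ ^ e)) (1ₚ^ e)

  rootProduct-const : ∀ k e → rootProduct k (λ _ → e) ≈ₚ rootProduct k (λ _ → 1) ^ e
  rootProduct-const zero e = ≈ₚ-sym (1ₚ^ e)
  rootProduct-const (suc k) e = begin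
    mulP (L ^ e) (rootProduct k (λ _ → e))                  ≈⟨ mulP-congʳ (L ^ e) (rootProduct-const k e) ⟩
    mulP (L ^ e) (rootProduct k (λ _ → 1) ^ e)              ≈⟨ mulP-congˡ _ (^-congˡ e (mulP-identityʳ L)) ⟨
    mulP ((L ^ 1) ^ e) (rootProduct k (λ _ → 1) ^ e)        ≈⟨ ^-distrib-* (L ^ 1) (rootProduct k (λ _ → 1)) e ⟨
    mulP (L ^ 1) (rootProduct k (λ _ → 1)) ^ e              ∎
    where open ≈ₚ-Reasoning
          L = linear (+ k)

  xᵖ-x : Polynomial
  xᵖ-x = xp-x₁ p

  eval-monomial : ∀ c j d → eval c (monoX₁ j d) ≈ c ℤ.^ j * d
  eval-monomial c zero d = ≡⇒≈ (identity c d)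
    where identity : ∀ c d → d + c * + 0 ≡ + 1 * d
          identity = solve-∀
  eval-monomial c (suc j) d = 𝔽.trans (𝔽.+-identityˡ _)
    (𝔽.trans (𝔽.*-congˡ {c} (eval-monomial c j d)) (𝔽.sym (𝔽.*-assoc c (c ℤ.^ j) d)))

  length-monomial : ∀ j d → length (monoX₁ j d) ≡ suc j
  length-monomial zero d = ≡.refl
  length-monomial (suc j) d = ≡.cong suc (length-monomial j d)

  coeff-monomial : ∀ j d → coeff (monoX₁ j d) j ≈ d
  coeff-monomial zero d = ≈-refl
  coeff-monomial (suc j) d = coeff-monomial j d

  xᵖ-x-root : ∀ a → eval (+ a) xᵖ-x ≈ + 0
  xᵖ-x-root a = begin
    eval (+ a) xᵖ-x                                              ≈⟨ eval-addP (+ a) (monoX₁ p (+ 1)) (monoX₁ 1 (- + 1)) ⟩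
    eval (+ a) (monoX₁ p (+ 1)) + eval (+ a) (monoX₁ 1 (- + 1))
      ≈⟨ 𝔽.+-cong (eval-monomial (+ a) p (+ 1)) (eval-monomial (+ a) 1 (- + 1)) ⟩
    (+ a) ℤ.^ p * + 1 + (+ a) ℤ.^ 1 * - + 1                      ≈⟨ 𝔽.+-congʳ (𝔽.*-congʳ (fermat-ℤ/pℤ p-prime a)) ⟩
    + a * + 1 + (+ a) ℤ.^ 1 * - + 1                              ≈⟨ ≡⇒≈ (identity (+ a)) ⟩
    + 0                                                          ∎
    where open ≈-Reasoning
          identity : ∀ x → x * + 1 + x * + 1 * - + 1 ≡ + 0
          identity = solve-∀

  xᵖ-x-monic : Monic xᵖ-x p
  xᵖ-x-monic = leading , deg
    where
    2≤p : 2 ≤ p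
    2≤p = ℕ.nonTrivial⇒n>1 p {{prime⇒nonTrivial p-prime}}
    deg-xᵖ : DegreeBelow (monoX₁ p (+ 1)) (suc p)
    deg-xᵖ = ≡.subst (DegreeBelow (monoX₁ p (+ 1))) (length-monomial p (+ 1)) (DegreeBelow-length (monoX₁ p (+ 1)))
    deg-x : DegreeBelow (monoX₁ 1 (- + 1)) p
    deg-x = DegreeBelow-mono {monoX₁ 1 (- + 1)} 2≤p
      (≡.subst (DegreeBelow (monoX₁ 1 (- + 1))) (length-monomial 1 (- + 1)) (DegreeBelow-length (monoX₁ 1 (- + 1))))
    leading : coeff xᵖ-x p ≈ + 1
    leading = 𝔽.trans (coeff-addP (monoX₁ p (+ 1)) (monoX₁ 1 (- + 1)) p)
      (𝔽.trans (𝔽.+-cong (coeff-monomial p (+ 1)) (deg-x p ℕP.≤-refl)) (𝔽.+-identityʳ (+ 1)))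
    deg : DegreeBelow xᵖ-x (suc p)
    deg i p<i = 𝔽.trans (coeff-addP (monoX₁ p (+ 1)) (monoX₁ 1 (- + 1)) i)
      (𝔽.trans (𝔽.+-cong (deg-xᵖ i p<i) (deg-x i (ℕP.<⇒≤ p<i))) (𝔽.+-identityʳ (+ 0)))

  -- both sides are monic of degree p, and the right one divides the left
  xᵖ-x≈∏linear : xᵖ-x ≈ₚ rootProduct p (λ _ → 1)
  xᵖ-x≈∏linear = equal (rootProduct-∣ p (λ _ → 1) xᵖ-x ℕP.≤-refl
    (λ i _ → ∣ʳ-respˡ-≈ (≈ₚ-sym (mulP-identityʳ (linear (+ i)))) (root⇒linear∣ (+ i) xᵖ-x (xᵖ-x-root i))))
    where
    P = rootProduct p (λ _ → 1)
    equal : P ∣ xᵖ-x → xᵖ-x ≈ₚ P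
    equal (h , hP≈xᵖ-x) =
      ≈ₚ-trans (≈ₚ-sym hP≈xᵖ-x) (≈ₚ-trans (mulP-congˡ P (≈ₚ-trans h≈constant (∷-cong h₀≈1 ≈ₚ-refl))) (mulP-identityˡ P))
      where
      Σ≡p : sumBelow p (λ _ → 1) ≡ p
      Σ≡p = ≡.trans (sumBelow-const p 1) (ℕP.*-identityʳ p)
      P-leading : coeff P p ≈ + 1
      P-leading = ≡.subst (λ d → coeff P d ≈ + 1) Σ≡p (proj₁ (rootProduct-monic p (λ _ → 1)))
      h≈constant : h ≈ₚ constant (coeff h 0)
      h≈constant = DegreeBelow-1⇒≈constant (DegreeBelow-cancel-rootProduct p (λ _ → 1) h 1
        (≡.subst (DegreeBelow (mulP P h)) (≡.trans (ℕP.+-comm 1 p) (≡.cong (ℕ._+ 1) (≡.sym Σ≡p)))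
          (DegreeBelow-cong (≈ₚ-trans (≈ₚ-sym hP≈xᵖ-x) (mulP-comm h P)) (proj₂ xᵖ-x-monic))))
      h₀≈1 : coeff h 0 ≈ + 1
      h₀≈1 = begin
        coeff h 0                  ≈⟨ 𝔽.*-identityʳ (coeff h 0) ⟨
        coeff h 0 * + 1            ≈⟨ 𝔽.*-congˡ {coeff h 0} P-leading ⟨
        coeff h 0 * coeff P p      ≈⟨ coeff-scale (coeff h 0) P p ⟨
        coeff (scale (coeff h 0) P) p
          ≈⟨ coeff-≈ (≈ₚ-trans (mulP-congˡ P h≈constant) (constant*≈scale (coeff h 0) P)) p ⟨
        coeff (mulP h P) p         ≈⟨ coeff-≈ hP≈xᵖ-x p ⟩
        coeff xᵖ-x p               ≈⟨ proj₁ xᵖ-x-monic ⟩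
        + 1                        ∎
        where open ≈-Reasoning

  xᵖ-x^-∣ : ∀ e g → (∀ i → i < p → linear (+ i) ^ e ∣ g) → xᵖ-x ^ e ∣ g
  xᵖ-x^-∣ e g divisors = ∣ʳ-respˡ-≈ (≈ₚ-trans (rootProduct-const p e) (^-congˡ e (≈ₚ-sym xᵖ-x≈∏linear)))
    (rootProduct-∣ p (λ _ → e) g ℕP.≤-refl divisors)

  linear^-∣-xᵖ-x^ : ∀ a e → linear (+ a) ^ e ∣ xᵖ-x ^ e
  linear^-∣-xᵖ-x^ a e = power (root⇒linear∣ (+ a) xᵖ-x (xᵖ-x-root a))
    where
    power : linear (+ a) ∣ xᵖ-x → linear (+ a) ^ e ∣ xᵖ-x ^ e
    power (q , qL≈xᵖ-x) = q ^ e , ≈ₚ-trans (≈ₚ-sym (^-distrib-* q (linear (+ a)) e)) (^-congˡ e qL≈xᵖ-x)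


module YDerivative {p : ℕ} (p-prime : Prime p) where

  open import Data.Nat as ℕ using (ℕ; zero; suc; _≤_; _∸_)
  import Data.Nat.Properties as ℕP
  open import Data.Integer as ℤ using (ℤ; +_; _+_; _*_)
  import Data.Integer.Properties as ℤP
  open import Data.Integer.Tactic.RingSolver using (solve-∀)
  open import Data.List using ([]; _∷_)
  open import Data.Product using (_,_)
  open import Relation.Binary.PropositionalEquality as ≡ using (_≡_)
  open import Defs using (dAux; dY₁; ∂y; ∂y^; atY)
  open Polynomials

  open IntegersModulo p
  open LinearFactors p-prime
  open ListPolynomial ℤ/pℤ
  open FormalDerivative ℤ/pℤ
  private
    module 𝔽 = CommutativeRing ℤ/pℤ
    module 𝔽[y] = ListPolynomial polynomialRing

  coeff-dAux : ∀ k f i → coeff (dAux k f) i ≈ + (k ℕ.+ i) * coeff f i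
  coeff-dAux k [] i = ≡⇒≈ (≡.sym (ℤP.*-zeroʳ (+ (k ℕ.+ i))))
  coeff-dAux k (c ∷ f) zero = ≡⇒≈ (≡.cong (λ x → + x * c) (≡.sym (ℕP.+-identityʳ k)))
  coeff-dAux k (c ∷ f) (suc i) = 𝔽.trans (coeff-dAux (suc k) f i) (≡⇒≈ (≡.cong (λ x → + x * coeff f i) (≡.sym (ℕP.+-suc k i))))

  coeff-D : ∀ f i → coeff (D f) i ≈ + (suc i) * coeff f (suc i)
  coeff-D [] i = ≡⇒≈ (≡.sym (ℤP.*-zeroʳ (+ (suc i))))
  coeff-D (a ∷ f) zero = 𝔽.trans (coeff-addP f (shift (D f)) zero) (≡⇒≈ (identity (coeff f 0)))
    where identity : ∀ x → x + + 0 ≡ + 1 * x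
          identity = solve-∀
  coeff-D (a ∷ f) (suc i) = 𝔽.trans (coeff-addP f (shift (D f)) (suc i))
    (𝔽.trans (𝔽.+-congˡ {coeff f (suc i)} (coeff-D f i)) (≡⇒≈ (identity (coeff f (suc i)) (+ (suc i)))))
    where identity : ∀ x n → x + n * x ≡ (+ 1 + n) * x
          identity = solve-∀

  dY₁≈D : ∀ f → dY₁ f ≈ₚ D f
  dY₁≈D [] = ≈ₚ-refl
  dY₁≈D (a ∷ f) = mk≈ₚ λ i → 𝔽.trans (coeff-dAux 1 f i) (𝔽.sym (coeff-D (a ∷ f) i))

  dY₁-cong : ∀ {f g} → f ≈ₚ g → dY₁ f ≈ₚ dY₁ g
  dY₁-cong {f} {g} f≈g = ≈ₚ-trans (dY₁≈D f) (≈ₚ-trans (D-cong f≈g) (≈ₚ-sym (dY₁≈D g)))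

  dY₁-addP : ∀ f g → dY₁ (addP f g) ≈ₚ addP (dY₁ f) (dY₁ g)
  dY₁-addP f g = ≈ₚ-trans (dY₁≈D (addP f g)) (≈ₚ-trans (D-addP f g) (addP-cong (≈ₚ-sym (dY₁≈D f)) (≈ₚ-sym (dY₁≈D g))))

  dY₁-mulP : ∀ f g → dY₁ (mulP f g) ≈ₚ addP (mulP (dY₁ f) g) (mulP f (dY₁ g))
  dY₁-mulP f g = ≈ₚ-trans (dY₁≈D (mulP f g)) (≈ₚ-trans (D-mulP f g)
    (addP-cong (mulP-congˡ g (≈ₚ-sym (dY₁≈D f))) (mulP-congʳ f (≈ₚ-sym (dY₁≈D g)))))

  dY₁-isDerivation : IsDerivation polynomialRing dY₁
  dY₁-isDerivation = record { cong = dY₁-cong ; +-homo = dY₁-addP ; leibniz = dY₁-mulP }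

  private
    module ∂ = CoefficientwiseDerivation polynomialRing dY₁ dY₁-isDerivation

  ∂y^-cong : ∀ α {f g} → f 𝔽[y].≈ₚ g → ∂y^ α f 𝔽[y].≈ₚ ∂y^ α g
  ∂y^-cong zero f≈g = f≈g
  ∂y^-cong (suc α) f≈g = ∂.map-cong (∂y^-cong α f≈g)

  ∂y^-addP : ∀ α f g → ∂y^ α (𝔽[y].addP f g) 𝔽[y].≈ₚ 𝔽[y].addP (∂y^ α f) (∂y^ α g)
  ∂y^-addP zero f g = 𝔽[y].≈ₚ-refl
  ∂y^-addP (suc α) f g = 𝔽[y].≈ₚ-trans (∂.map-cong (∂y^-addP α f g)) (∂.map-addP (∂y^ α f) (∂y^ α g))

  ∂y^-suc : ∀ α f → ∂y^ α (∂y f) ≡ ∂y^ (suc α) f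
  ∂y^-suc zero f = ≡.refl
  ∂y^-suc (suc α) f = ≡.cong ∂y (∂y^-suc α f)

  module AtSlope (m : ℤ) where

    private
      module ev = CoefficientwiseHomomorphism polynomialRing ℤ/pℤ (eval m) (eval-isRingHomomorphism m)
    open ev public using () renaming
        (coeff-map to coeff-atY; map-cong to atY-cong; map-addP to atY-addP; map-mulP to atY-mulP; map-powP to atY-powP)

    -- an order of vanishing at x = c on the line y = m that survives y-differentiation;
    -- by the Leibniz rule it is additive under products (Vanishes-mulP)
    Vanishes : ℤ → ℕ → 𝔽[y].Polynomial → Set
    Vanishes c e f = ∀ α → linear c ^ (e ∸ α) ∣ atY (∂y^ α f) m

    Vanishes-weaken : ∀ {c e e′ f} → e′ ≤ e → Vanishes c e f → Vanishes c e′ f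
    Vanishes-weaken {c} e′≤e vanishes α = ∣ʳ-trans (^-∣-^ (linear c) (ℕP.∸-monoˡ-≤ α e′≤e)) (vanishes α)

    Vanishes-0 : ∀ c f → Vanishes c 0 f
    Vanishes-0 c f zero = ε∣ʳ atY f m
    Vanishes-0 c f (suc α) = ε∣ʳ atY (∂y^ (suc α) f) m

    Vanishes-1 : ∀ c f → linear c ∣ atY f m → Vanishes c 1 f
    Vanishes-1 c f L∣f zero = ∣ʳ-respˡ-≈ (≈ₚ-sym (mulP-identityʳ (linear c))) L∣f
    Vanishes-1 c f L∣f (suc α) = ≡.subst (λ k → linear c ^ k ∣ atY (∂y^ (suc α) f) m) (≡.sym (ℕP.0∸n≡0 α))
      (ε∣ʳ atY (∂y^ (suc α) f) m)

    Vanishes-∂ : ∀ {c e f} → Vanishes c e f → Vanishes c (e ∸ 1) (∂y f)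
    Vanishes-∂ {c} {e} {f} vanishes α =
      ≡.subst₂ (λ k g → linear c ^ k ∣ atY g m) (≡.sym (ℕP.∸-+-assoc e 1 α)) (≡.sym (∂y^-suc α f)) (vanishes (suc α))

    Vanishes-mulP : ∀ {c e₁ e₂ f g} → Vanishes c e₁ f → Vanishes c e₂ g → Vanishes c (e₁ ℕ.+ e₂) (𝔽[y].mulP f g)
    Vanishes-mulP {c} {e₁} {e₂} {f} {g} vanishes₁ vanishes₂ zero =
      ∣ʳ-respʳ-≈ (≈ₚ-sym (atY-mulP f g)) (∣ʳ-respˡ-≈ (≈ₚ-sym (^-homo-* (linear c) e₁ e₂)) (∙-cong-∣ (vanishes₁ 0) (vanishes₂ 0)))
    Vanishes-mulP {c} {e₁} {e₂} {f} {g} vanishes₁ vanishes₂ (suc α) =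
      ≡.subst (λ h → linear c ^ (e₁ ℕ.+ e₂ ∸ suc α) ∣ atY h m) (∂y^-suc α (𝔽[y].mulP f g))
        (∣ʳ-respʳ-≈ (≈ₚ-sym leibniz) (∣-addP left right))
      where
      lowered₁ : ∀ x y a → (x ℕ.+ y) ∸ suc a ≤ ((x ∸ 1) ℕ.+ y) ∸ a
      lowered₁ zero y a = ℕP.∸-monoʳ-≤ y (ℕP.n≤1+n a)
      lowered₁ (suc x) y a = ℕP.≤-refl
      lowered₂ : ∀ x y a → (x ℕ.+ y) ∸ suc a ≤ (x ℕ.+ (y ∸ 1)) ∸ a
      lowered₂ x y a = ≡.subst₂ (λ u v → u ∸ suc a ≤ v ∸ a) (ℕP.+-comm y x) (ℕP.+-comm (y ∸ 1) x) (lowered₁ y x a)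
      left : linear c ^ (e₁ ℕ.+ e₂ ∸ suc α) ∣ atY (∂y^ α (𝔽[y].mulP (∂y f) g)) m
      left = ∣ʳ-trans (^-∣-^ (linear c) (lowered₁ e₁ e₂ α)) (Vanishes-mulP (Vanishes-∂ vanishes₁) vanishes₂ α)
      right : linear c ^ (e₁ ℕ.+ e₂ ∸ suc α) ∣ atY (∂y^ α (𝔽[y].mulP f (∂y g))) m
      right = ∣ʳ-trans (^-∣-^ (linear c) (lowered₂ e₁ e₂ α)) (Vanishes-mulP vanishes₁ (Vanishes-∂ vanishes₂) α)
      leibniz : atY (∂y^ α (∂y (𝔽[y].mulP f g))) m
                ≈ₚ addP (atY (∂y^ α (𝔽[y].mulP (∂y f) g)) m) (atY (∂y^ α (𝔽[y].mulP f (∂y g))) m)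
      leibniz = ≈ₚ-trans (atY-cong
          (𝔽[y].≈ₚ-trans (∂y^-cong α (∂.map-mulP f g)) (∂y^-addP α (𝔽[y].mulP (∂y f) g) (𝔽[y].mulP f (∂y g)))))
                          (atY-addP (∂y^ α (𝔽[y].mulP (∂y f) g)) (∂y^ α (𝔽[y].mulP f (∂y g))))


module RedeiAtSlope {q : ℕ} (p-prime : Prime (suc q)) (m : Fin (suc q)) where

  open import Data.Nat as ℕ using (ℕ; zero; suc; _≤_; _<_; _∸_; z≤n; s≤s; _%_)
  import Data.Nat.Properties as ℕP
  import Data.Nat.DivMod as ℕD
  open import Data.Integer as ℤ using (+_; -_; _+_; _*_; _-_)
  import Data.Integer.Properties as ℤP
  open import Data.Integer.Tactic.RingSolver using (solve-∀)
  open import Data.Fin as Fin using (Fin; toℕ)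
  import Data.Fin.Properties as FinP
  open import Data.List using ([]; _∷_; length)
  import Data.List.Properties as ListP
  open import Data.Product using (Σ; ∃; _,_; _×_; proj₁; proj₂)
  open import Data.Sum using ([_,_]′; inj₁; inj₂)
  open import Relation.Nullary using (¬_; Dec; yes; no)
  open import Relation.Binary.PropositionalEquality as ≡ using (_≡_)
  open import Defs using (Point; redeiFactor; Redei; lineCount; atY)
  open Polynomials
  open FiniteSums using (sumBelow; sumBelow-mono-<)

  private
    p : ℕ
    p = suc q
    module 𝔽 = CommutativeRing (IntegersModulo.ℤ/pℤ p)
  open IntegersModulo p
  open ListPolynomial ℤ/pℤ
  open LinearFactors p-prime
  open YDerivative p-prime
  open AtSlope (+ toℕ m)
  open import Algebra.Properties.CommutativeSemigroup (CommutativeRing.*-commutativeSemigroup polynomialRing) using (x∙yz≈y∙xz)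

  OnLine : Point p → Fin p → Set
  OnLine (u , v) k = (toℕ v ℕ.+ toℕ k) % p ≡ (toℕ m ℕ.* toℕ u) % p

  onLine? : ∀ u v k → Dec (OnLine (u , v) k)
  onLine? u v k = (toℕ v ℕ.+ toℕ k) % p ℕP.≟ (toℕ m ℕ.* toℕ u) % p

  lineCount-on : ∀ u v U k → OnLine (u , v) k → lineCount ((u , v) ∷ U) m k ≡ suc (lineCount U m k)
  lineCount-on u v U k on = ≡.cong length (ListP.filter-accept (λ pt → onLine? (proj₁ pt) (proj₂ pt) k) {(u , v)} {U} on)

  lineCount-off : ∀ u v U k → ¬ OnLine (u , v) k → lineCount ((u , v) ∷ U) m k ≡ lineCount U m k
  lineCount-off u v U k off = ≡.cong length (ListP.filter-reject (λ pt → onLine? (proj₁ pt) (proj₂ pt) k) {(u , v)} {U} off)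

  -- the factor x − a y + b of R_U, at y = m, is x − k exactly when b = m a − k
  redeiFactor-on : ∀ u v k → OnLine (u , v) k → atY (redeiFactor (u , v)) (+ toℕ m) ≈ₚ linear (+ toℕ k)
  redeiFactor-on u v k on = ∷-cong constant-term (∷-cong (≡⇒≈ (identity₂ M)) ≈ₚ-refl)
    where
    M = + toℕ m
    V = + toℕ v
    K = + toℕ k
    A = + toℕ u
    V+K≈MA : V + K ≈ M * A
    V+K≈MA = 𝔽.trans (≡⇒≈ (≡.sym (ℤP.pos-+ (toℕ v) (toℕ k))))
               (𝔽.trans (%≡%⇒≈ _ _ on) (≡⇒≈ (ℤP.pos-* (toℕ m) (toℕ u))))
    identity₁ : ∀ V K M A → V + M * (- A + M * + 0) ≡ ((V + K) - M * A) - K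
    identity₁ = solve-∀
    identity₂ : ∀ M → + 1 + M * + 0 ≡ + 1
    identity₂ = solve-∀
    identity₃ : ∀ X K → (X - X) - K ≡ - K
    identity₃ = solve-∀
    constant-term : V + M * (- A + M * + 0) ≈ - K
    constant-term = 𝔽.trans (≡⇒≈ (identity₁ V K M A))
      (𝔽.trans (𝔽.+-congʳ { - K} (𝔽.+-congʳ { - (M * A)} V+K≈MA)) (≡⇒≈ (identity₃ (M * A) K)))

  redeiFactor-off : ∀ u v k → ¬ OnLine (u , v) k → ¬ eval (+ toℕ k) (atY (redeiFactor (u , v)) (+ toℕ m)) ≈ + 0
  redeiFactor-off u v k off root = off (≈⇒%≡% _ _ (𝔽.trans (≡⇒≈ (ℤP.pos-+ (toℕ v) (toℕ k)))
    (𝔽.trans (a-b≈0⇒a≈b (𝔽.trans (≡⇒≈ (identity V K M A)) root)) (≡⇒≈ (≡.sym (ℤP.pos-* (toℕ m) (toℕ u)))))))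
    where
    M = + toℕ m
    V = + toℕ v
    K = + toℕ k
    A = + toℕ u
    identity : ∀ V K M A → (V + K) - M * A ≡ (V + M * (- A + M * + 0)) + K * ((+ 1 + M * + 0) + K * + 0)
    identity = solve-∀

  Redei-vanishes : ∀ U k → Vanishes (+ toℕ k) (lineCount U m k) (Redei U)
  Redei-vanishes [] k = Vanishes-0 (+ toℕ k) (Redei {p} [])
  Redei-vanishes ((u , v) ∷ U) k with onLine? u v k
  ... | yes on = ≡.subst (λ e → Vanishes (+ toℕ k) e (Redei ((u , v) ∷ U))) (≡.sym (lineCount-on u v U k on))
    (Vanishes-mulP {e₁ = 1} (Vanishes-1 (+ toℕ k) (redeiFactor (u , v)) (∣ʳ-reflexive (≈ₚ-sym (redeiFactor-on u v k on))))
                            (Redei-vanishes U k))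
  ... | no off = ≡.subst (λ e → Vanishes (+ toℕ k) e (Redei ((u , v) ∷ U))) (≡.sym (lineCount-off u v U k off))
    (Vanishes-mulP {e₁ = 0} (Vanishes-0 (+ toℕ k) (redeiFactor (u , v))) (Redei-vanishes U k))

  RedeiCofactor : List (Point p) → Fin p → Set
  RedeiCofactor U k = Σ Polynomial λ Q →
    atY (Redei U) (+ toℕ m) ≈ₚ mulP (linear (+ toℕ k) ^ lineCount U m k) Q × ¬ eval (+ toℕ k) Q ≈ + 0

  Redei-cofactor : ∀ U k → RedeiCofactor U k
  Redei-cofactor [] k = 1ₚ , ∷-cong (≡⇒≈ (identity (+ toℕ m))) ≈ₚ-refl , λ 1≈0 → 1≉0 p-prime
      (𝔽.trans (𝔽.sym (eval-1ₚ (+ toℕ k))) 1≈0)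
    where identity : ∀ M → + 1 + M * + 0 ≡ + 1 * + 1 + + 0
          identity = solve-∀
  Redei-cofactor ((u , v) ∷ U) k = extend (onLine? u v k) (Redei-cofactor U k)
    where
    L = linear (+ toℕ k)
    F = atY (redeiFactor (u , v)) (+ toℕ m)
    c = lineCount U m k
    atY-Redei : atY (Redei ((u , v) ∷ U)) (+ toℕ m) ≈ₚ mulP F (atY (Redei U) (+ toℕ m))
    atY-Redei = atY-mulP (redeiFactor (u , v)) (Redei U)
    extend : Dec (OnLine (u , v) k) → RedeiCofactor U k → RedeiCofactor ((u , v) ∷ U) k
    extend (yes on) (Q , R≈LᶜQ , Q[k]≉0) =
      Q , ≡.subst (λ e → atY (Redei ((u , v) ∷ U)) (+ toℕ m) ≈ₚ mulP (L ^ e) Q) (≡.sym (lineCount-on u v U k on))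
            (≈ₚ-trans atY-Redei (≈ₚ-trans (mulP-cong (redeiFactor-on u v k on) R≈LᶜQ) (≈ₚ-sym (mulP-assoc L (L ^ c) Q))))
        , Q[k]≉0
    extend (no off) (Q , R≈LᶜQ , Q[k]≉0) =
      mulP F Q , ≡.subst (λ e → atY (Redei ((u , v) ∷ U)) (+ toℕ m) ≈ₚ mulP (L ^ e) (mulP F Q))
          (≡.sym (lineCount-off u v U k off))
                   (≈ₚ-trans atY-Redei (≈ₚ-trans (mulP-congʳ F R≈LᶜQ) (x∙yz≈y∙xz F (L ^ c) Q)))
        , λ FQ[k]≈0 → [ redeiFactor-off u v k off , Q[k]≉0 ]′
            (a*b≈0⇒a≈0∨b≈0 p-prime (eval (+ toℕ k) F) (eval (+ toℕ k) Q) (𝔽.trans (𝔽.sym (eval-mulP (+ toℕ k) F Q)) FQ[k]≈0))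

  toFin : ℕ → Fin p
  toFin i = Fin.fromℕ< (ℕD.m%n<n i p)

  toℕ-toFin : ∀ {i} → i < p → toℕ (toFin i) ≡ i
  toℕ-toFin {i} i<p = ≡.trans (FinP.toℕ-fromℕ< (ℕD.m%n<n i p)) (ℕD.m<n⇒m%n≡m i<p)

  multiplicity : List (Point p) → ℕ → ℕ
  multiplicity U i = lineCount U m (toFin i)

  -- (u, v) lies on the line with k ≡ m u − v
  some-line : ∀ u v → ∃ λ i → i < p × OnLine (u , v) (toFin i)
  some-line u v = X % p , ℕD.m%n<n X p , on
    where
    X = toℕ m ℕ.* toℕ u ℕ.+ (p ∸ toℕ v)
    open import Algebra.Properties.CommutativeSemigroup ℕP.+-commutativeSemigroup
      using () renaming (x∙yz≈y∙xz to x+[y+z]≡y+[x+z])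
    v+X≡mu+p : toℕ v ℕ.+ X ≡ toℕ m ℕ.* toℕ u ℕ.+ p
    v+X≡mu+p = ≡.trans (x+[y+z]≡y+[x+z] (toℕ v) (toℕ m ℕ.* toℕ u) (p ∸ toℕ v))
                 (≡.cong (toℕ m ℕ.* toℕ u ℕ.+_) (ℕP.m+[n∸m]≡n (ℕP.<⇒≤ (FinP.toℕ<n v))))
    on : (toℕ v ℕ.+ toℕ (toFin (X % p))) % p ≡ (toℕ m ℕ.* toℕ u) % p
    on = begin
      (toℕ v ℕ.+ toℕ (toFin (X % p))) % p   ≡⟨ ≡.cong (λ z → (toℕ v ℕ.+ z) % p) (toℕ-toFin (ℕD.m%n<n X p)) ⟩
      (toℕ v ℕ.+ X % p) % p                 ≡⟨ ℕD.%-distribˡ-+ (toℕ v) (X % p) p ⟩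
      (toℕ v % p ℕ.+ X % p % p) % p         ≡⟨ ≡.cong (λ z → (toℕ v % p ℕ.+ z) % p) (ℕD.m%n%n≡m%n X p) ⟩
      (toℕ v % p ℕ.+ X % p) % p             ≡⟨ ℕD.%-distribˡ-+ (toℕ v) X p ⟨
      (toℕ v ℕ.+ X) % p                     ≡⟨ ≡.cong (_% p) v+X≡mu+p ⟩
      (toℕ m ℕ.* toℕ u ℕ.+ p) % p           ≡⟨ ℕD.[m+n]%n≡m%n (toℕ m ℕ.* toℕ u) p ⟩
      (toℕ m ℕ.* toℕ u) % p                 ∎
      where open ≡.≡-Reasoning

  lineCount-∷-≥ : ∀ u v U k → lineCount U m k ≤ lineCount ((u , v) ∷ U) m k
  lineCount-∷-≥ u v U k with onLine? u v k
  ... | yes on = ℕP.≤-trans (ℕP.n≤1+n _) (ℕP.≤-reflexive (≡.sym (lineCount-on u v U k on)))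
  ... | no off = ℕP.≤-reflexive (≡.sym (lineCount-off u v U k off))

  length≤Σmultiplicity : ∀ U → length U ≤ sumBelow p (multiplicity U)
  length≤Σmultiplicity [] = z≤n
  length≤Σmultiplicity ((u , v) ∷ U) with some-line u v
  ... | i , i<p , on = ℕP.≤-trans (s≤s (length≤Σmultiplicity U))
    (sumBelow-mono-< p (multiplicity U) (multiplicity ((u , v) ∷ U)) (λ j _ → lineCount-∷-≥ u v U (toFin j)) i i<p
      (ℕP.≤-reflexive (≡.sym (lineCount-on u v U (toFin i) on))))


module NonSpecial {p : ℕ} (U : List (Point p)) (m k : Fin p) where

  open import Data.Nat as ℕ using (suc; _≤_; _<_; _∸_)
  import Data.Nat.Properties as ℕP
  open import Data.List using (length)
  open import Data.Empty using (⊥-elim)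
  open import Relation.Nullary using (¬_; yes; no)
  open import Defs using (lineCount; Rich; Poor)

  private
    c = lineCount U m k

  ¬Poor⇒≥ : ∀ n → (n ∸ 1) ℕ.* p < length U → ¬ Poor U m k → n ∸ 1 ≤ c
  ¬Poor⇒≥ n lower ¬poor with (n ∸ 1) ℕP.≤? c
  ... | yes ≥ = ≥
  ... | no ≱ = ⊥-elim (¬poor (begin
    p ℕ.* c ℕ.+ p    ≡⟨ ℕP.+-comm (p ℕ.* c) p ⟩
    p ℕ.+ p ℕ.* c    ≡⟨ ℕP.*-suc p c ⟨
    p ℕ.* suc c      ≤⟨ ℕP.*-monoʳ-≤ p (ℕP.≰⇒> ≱) ⟩
    p ℕ.* (n ∸ 1)    ≡⟨ ℕP.*-comm p (n ∸ 1) ⟩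
    (n ∸ 1) ℕ.* p    <⟨ lower ⟩
    length U         ∎))
    where open ℕP.≤-Reasoning

  ¬Rich⇒≤ : ∀ n → length U ≤ n ℕ.* p → ¬ Rich U m k → c ≤ n
  ¬Rich⇒≤ n upper ¬rich with c ℕP.≤? n
  ... | yes ≤ = ≤
  ... | no ≰ = ⊥-elim (¬rich (begin
    length U ℕ.+ p    ≤⟨ ℕP.+-monoˡ-≤ p upper ⟩
    n ℕ.* p ℕ.+ p     ≡⟨ ℕP.+-comm (n ℕ.* p) p ⟩
    suc n ℕ.* p       ≤⟨ ℕP.*-monoˡ-≤ p (ℕP.≰⇒> ≰) ⟩
    c ℕ.* p           ≡⟨ ℕP.*-comm c p ⟩
    p ℕ.* c           ∎))
    where open ℕP.≤-Reasoning


module DerivativeDivisibility {q : ℕ} (p-prime : Prime (suc q)) (m : Fin (suc q)) where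

  open import Data.Nat as ℕ using (zero; suc; _≤_; _<_; _∸_)
  import Data.Nat.Properties as ℕP
  open import Data.Integer using (+_; -_; _+_)
  import Data.Integer.Properties as ℤP
  open import Data.Fin using (toℕ)
  open import Data.List using ([]; _∷_; length)
  open import Data.Product using (_,_)
  open import Relation.Nullary using (yes; no)
  import Relation.Binary.PropositionalEquality as ≡
  open import Defs using (Redei; lineCount; xp-x₂; monoX₂; monoX₁; atY; ∂y^)
  open Polynomials

  private
    module 𝔽 = CommutativeRing (IntegersModulo.ℤ/pℤ (suc q))
  open IntegersModulo (suc q)
  open ListPolynomial ℤ/pℤ
  open LinearFactors p-prime
  open YDerivative p-prime
  open AtSlope (+ toℕ m)
  open RedeiAtSlope p-prime m
  module 𝔽[y] = ListPolynomial polynomialRing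
  open import Algebra.Properties.Group (CommutativeRing.+-group polynomialRing) using (y≈x\\z)

  atY-monoX₂ : ∀ k c d → eval (+ toℕ m) c ≈ d → atY (monoX₂ k c) (+ toℕ m) ≈ₚ monoX₁ k d
  atY-monoX₂ zero c d c[m]≈d = ∷-cong c[m]≈d ≈ₚ-refl
  atY-monoX₂ (suc k) c d c[m]≈d = ∷-cong ≈-refl (atY-monoX₂ k c d c[m]≈d)

  atY-xᵖ-x : atY (xp-x₂ (suc q)) (+ toℕ m) ≈ₚ xᵖ-x
  atY-xᵖ-x = ≈ₚ-trans (atY-addP (monoX₂ (suc q) (+ 1 ∷ [])) (monoX₂ 1 (- + 1 ∷ [])))
    (addP-cong (atY-monoX₂ (suc q) (+ 1 ∷ []) (+ 1) (≡⇒≈ (≡.cong (_+_ (+ 1)) (ℤP.*-zeroʳ (+ toℕ m)))))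
               (atY-monoX₂ 1 (- + 1 ∷ []) (- + 1) (≡⇒≈ (≡.cong (_+_ (- + 1)) (ℤP.*-zeroʳ (+ toℕ m))))))

  module _ (n : ℕ) (U : List (Point (suc q))) (S T : 𝔽[y].Polynomial)
           (xᵖ-xⁿ≈RS+T : 𝔽[y].powP (xp-x₂ (suc q)) n 𝔽[y].≈ₚ 𝔽[y].addP (𝔽[y].mulP (Redei U) S) T)
           (T-degree : ∀ i → length U ≤ i → 𝔽[y].coeff T i ≈ₚ [])
           (lower : ∀ k → n ∸ 1 ≤ lineCount U m k) (upper : ∀ k → lineCount U m k ≤ n)
           where

    private
      R′ = atY (Redei U) (+ toℕ m)
      S′ = atY S (+ toℕ m)
      T′ = atY T (+ toℕ m)
      H = 𝔽[y].mulP (Redei U) S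

    xᵖ-xⁿ≈R′S′+T′ : xᵖ-x ^ n ≈ₚ addP (mulP R′ S′) T′
    xᵖ-xⁿ≈R′S′+T′ =
      ≈ₚ-trans (≈ₚ-sym (^-congˡ n atY-xᵖ-x)) (≈ₚ-trans (≈ₚ-reflexive (≡.sym (powP≡^ (atY (xp-x₂ (suc q)) (+ toℕ m)) n)))
      (≈ₚ-trans (≈ₚ-sym (atY-powP (xp-x₂ (suc q)) n)) (≈ₚ-trans (atY-cong xᵖ-xⁿ≈RS+T)
      (≈ₚ-trans (atY-addP H T) (addP-cong (atY-mulP (Redei U) S) (≈ₚ-refl {T′}))))))

    T′≈[] : T′ ≈ₚ []
    T′≈[] = many-roots⇒≈[] (suc q) (multiplicity U) T′ ℕP.≤-refl divides
      (DegreeBelow-mono {T′} (length≤Σmultiplicity U) T′-degree)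
      where
      T′-degree : DegreeBelow T′ (length U)
      T′-degree i U≤i = 𝔽.trans (coeff-atY T i) (eval-[] (+ toℕ m) (≈ₚ-sym (T-degree i U≤i)))
      T′≈xᵖ-xⁿ-R′S′ : T′ ≈ₚ addP (negate (mulP R′ S′)) (xᵖ-x ^ n)
      T′≈xᵖ-xⁿ-R′S′ = y≈x\\z (mulP R′ S′) T′ (xᵖ-x ^ n) (≈ₚ-sym xᵖ-xⁿ≈R′S′+T′)
      divides-Fin : ∀ k → linear (+ toℕ k) ^ lineCount U m k ∣ T′
      divides-Fin k = ∣ʳ-respʳ-≈ (≈ₚ-sym T′≈xᵖ-xⁿ-R′S′) (∣-addP
        (∣-negate (∣ʳ-respʳ-≈ (mulP-comm S′ R′) (x∣ʳy⇒x∣ʳzy S′ (Redei-vanishes U k 0))))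
        (∣ʳ-trans (^-∣-^ (linear (+ toℕ k)) (upper k)) (linear^-∣-xᵖ-x^ (toℕ k) n)))
      divides : ∀ i → i < suc q → linear (+ i) ^ multiplicity U i ∣ T′
      divides i i<p = ≡.subst (λ j → linear (+ j) ^ multiplicity U i ∣ T′) (toℕ-toFin i<p) (divides-Fin (toFin i))

    xᵖ-xⁿ≈R′S′ : xᵖ-x ^ n ≈ₚ mulP R′ S′
    xᵖ-xⁿ≈R′S′ = ≈ₚ-trans xᵖ-xⁿ≈R′S′+T′ (≈ₚ-trans (addP-cong (≈ₚ-refl {mulP R′ S′}) T′≈[]) (addP-identityʳ (mulP R′ S′)))

    -- on a line with n − 1 points the missing factor x − k must come from S
    S′-root : ∀ k → lineCount U m k < n → linear (+ toℕ k) ∣ S′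
    S′-root k c<n = from-cofactor (Redei-cofactor U k)
      where
      L = linear (+ toℕ k)
      c = lineCount U m k
      r = n ∸ c
      from-cofactor : RedeiCofactor U k → L ∣ S′
      from-cofactor (Q , R′≈LᶜQ , Q[k]≉0) = ∣ʳ-respˡ-≈ (mulP-identityʳ L) (∣ʳ-trans (^-∣-^ L (ℕP.m<n⇒0<n∸m c<n)) Lʳ∣S′)
        where
        xᵖ-xⁿ≈LᶜQS′ : xᵖ-x ^ n ≈ₚ mulP (L ^ c) (mulP Q S′)
        xᵖ-xⁿ≈LᶜQS′ = ≈ₚ-trans xᵖ-xⁿ≈R′S′ (≈ₚ-trans (mulP-congˡ S′ R′≈LᶜQ) (mulP-assoc (L ^ c) Q S′))
        Lᶜ⁺ʳ∣LᶜQS′ : L ^ (c ℕ.+ r) ∣ mulP (L ^ c) (mulP Q S′)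
        Lᶜ⁺ʳ∣LᶜQS′ = ≡.subst (λ e → L ^ e ∣ mulP (L ^ c) (mulP Q S′)) (≡.sym (ℕP.m+[n∸m]≡n (ℕP.<⇒≤ c<n)))
          (∣ʳ-respʳ-≈ xᵖ-xⁿ≈LᶜQS′ (linear^-∣-xᵖ-x^ (toℕ k) n))
        Lʳ∣S′ : L ^ r ∣ S′
        Lʳ∣S′ = ∣-cancel-nonroot (+ toℕ k) Q S′ r Q[k]≉0 (∣-cancel-linear^ (+ toℕ k) c r Lᶜ⁺ʳ∣LᶜQS′)

    H-vanishes : ∀ k → Vanishes (+ toℕ k) n H
    H-vanishes k with lineCount U m k ℕP.<? n
    ... | yes c<n = Vanishes-weaken n≤c+1 (Vanishes-mulP (Redei-vanishes U k) (Vanishes-1 (+ toℕ k) S (S′-root k c<n)))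
      where
      n≤c+1 : n ≤ lineCount U m k ℕ.+ 1
      n≤c+1 = ℕP.≤-trans (ℕP.m≤n+m∸n n 1) (ℕP.≤-trans (ℕP.+-monoʳ-≤ 1 (lower k)) (ℕP.≤-reflexive (ℕP.+-comm 1 (lineCount U m k))))
    ... | no c≮n = Vanishes-weaken n≤c+0 (Vanishes-mulP (Redei-vanishes U k) (Vanishes-0 (+ toℕ k) S))
      where
      n≤c+0 : n ≤ lineCount U m k ℕ.+ 0
      n≤c+0 = ℕP.≤-trans (ℕP.≮⇒≥ c≮n) (ℕP.≤-reflexive (≡.sym (ℕP.+-identityʳ (lineCount U m k))))

    xᵖ-x^-∣-∂y^H : ∀ α → powP xᵖ-x (n ∸ α) ∣ atY (∂y^ α H) (+ toℕ m)
    xᵖ-x^-∣-∂y^H α = ≡.subst (_∣ atY (∂y^ α H) (+ toℕ m)) (≡.sym (powP≡^ xᵖ-x (n ∸ α)))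
      (xᵖ-x^-∣ (n ∸ α) (atY (∂y^ α H) (+ toℕ m)) λ i i<p →
        ≡.subst (λ j → linear (+ j) ^ (n ∸ α) ∣ atY (∂y^ α H) (+ toℕ m)) (toℕ-toFin i<p) (H-vanishes (toFin i) α))


module DefsCorrespondence (p : ℕ) where

  open import Data.Nat using (zero; suc; _≤_)
  open import Data.List using ([]; _∷_)
  open import Data.Product using (_,_)
  open import Relation.Binary.PropositionalEquality as ≡ using (_≡_)
  import Defs
  open Polynomials

  open IntegersModulo p
  open ListPolynomial ℤ/pℤ
  module 𝔽[y] = ListPolynomial polynomialRing
  open import Algebra.Definitions.RawMagma (CommutativeRing.*-rawMagma polynomialRing) using (_∣_; _,_)

  coeff≡coeff : ∀ f i → coeff f i ≡ Defs.coeff f i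
  coeff≡coeff [] i = ≡.refl
  coeff≡coeff (a ∷ f) zero = ≡.refl
  coeff≡coeff (a ∷ f) (suc i) = coeff≡coeff f i

  coeff₂≡coeff₂ : ∀ f i → 𝔽[y].coeff f i ≡ Defs.coeff₂ f i
  coeff₂≡coeff₂ [] i = ≡.refl
  coeff₂≡coeff₂ (a ∷ f) zero = ≡.refl
  coeff₂≡coeff₂ (a ∷ f) (suc i) = coeff₂≡coeff₂ f i

  ≈₁⇒≈ₚ : ∀ f g → f Defs.≈₁ g [mod p ] → f ≈ₚ g
  ≈₁⇒≈ₚ f g f≈g = mk≈ₚ λ j → mk≈
      (≡.subst₂ (λ a b → a Defs.≡ b [mod p ]) (≡.sym (coeff≡coeff f j)) (≡.sym (coeff≡coeff g j)) (f≈g j))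

  ≈ₚ⇒≈₁ : ∀ f g → f ≈ₚ g → f Defs.≈₁ g [mod p ]
  ≈ₚ⇒≈₁ f g f≈g j = ≡.subst₂ (λ a b → a Defs.≡ b [mod p ]) (coeff≡coeff f j) (coeff≡coeff g j) (p∣a-b (coeff-≈ f≈g j))

  ≈₂⇒≈ₚ : ∀ f g → f Defs.≈₂ g [mod p ] → f 𝔽[y].≈ₚ g
  ≈₂⇒≈ₚ f g f≈g = 𝔽[y].mk≈ₚ λ i → ≡.subst₂ _≈ₚ_ (≡.sym (coeff₂≡coeff₂ f i)) (≡.sym (coeff₂≡coeff₂ g i))
    (≈₁⇒≈ₚ (Defs.coeff₂ f i) (Defs.coeff₂ g i) (f≈g i))

  DegXBelow⇒ : ∀ f d → Defs.DegXBelow f d p → ∀ i → d ≤ i → 𝔽[y].coeff f i ≈ₚ []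
  DegXBelow⇒ f d deg i d≤i = ≡.subst (_≈ₚ []) (≡.sym (coeff₂≡coeff₂ f i))
    (≈₁⇒≈ₚ (Defs.coeff₂ f i) [] (λ j → deg i j d≤i))

  ∣⇒∣₁ : ∀ g f → g ∣ f → g Defs.∣₁ f [mod p ]
  ∣⇒∣₁ g f (h , hg≈f) = h , ≈ₚ⇒≈₁ f (mulP g h) (≈ₚ-trans (≈ₚ-sym hg≈f) (mulP-comm h g))


open import Defs
open import Data.Nat using (_∸_; _*_; _<_; _≤_; _+_)
open import Data.Integer using (+_)
open import Data.Fin using (toℕ)
open import Data.List using (length)
open import Data.List.Relation.Unary.Unique.Propositional using (Unique)
open import Data.Product using (_,_)
open import Data.Sum using (inj₁; inj₂)
open import Relation.Nullary using (¬_)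

proposition3p7 :
    (p : ℕ) → Prime p → (n : ℕ) → 1 ≤ n →
    (U : List (Point p)) → Unique U →
    (n ∸ 1) * p < length U → length U ≤ n * p →
    (m : Fin p) → ¬ Special U m →
    (α : ℕ) → α ≤ n →
    -- S = S_{U,n}, T = T_{U,n}: quotient and remainder of (x^p - x)^n by R_U
    (S T : BiPoly) →
    P2.powP (xp-x₂ p) n ≈₂ P2.addP (Redei U *₂ S) T [mod p ] →
    DegXBelow T (length U) p →
    -- (x^p - x)^(n-α) divides (∂_y^α H_{U,n})(x, m) in 𝔽_p[x]
    P1.powP (xp-x₁ p) (n ∸ α) ∣₁ atY (∂y^ α (Redei U *₂ S)) (+ toℕ m) [mod p ]
-- Prime 0 is empty.
proposition3p7 (suc q) p-prime n _ U _ lower upper m ¬special α _ S T decomposition T-degree =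
  ∣⇒∣₁ _ _ (xᵖ-x^-∣-∂y^H p-prime m n U S T
    (≈₂⇒≈ₚ _ _ decomposition) (DegXBelow⇒ T (length U) T-degree)
    (λ k → ¬Poor⇒≥ U m k n lower (λ poor → ¬special (k , inj₂ poor)))
    (λ k → ¬Rich⇒≤ U m k n upper (λ rich → ¬special (k , inj₁ rich)))
    α)
  where
  open DefsCorrespondence (suc q)
  open DerivativeDivisibility
  open NonSpecial
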